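{- Let $n$ be a positive even integer and let $L$ be an almost balanced Gray code for $\mathcal{P}^{\mathrm{all}}_n$ starting at $12\cdots n$ and ending at $23\cdots n1$. Then there exists a balanced Gray code for $\mathcal{P}^{\mathrm{all}}_{n+1}$ starting at $12\cdots n(n+1)$ and ending at $12\cdots (n+1)n$, whose closing transposition is $(n,n+1)$.
   Context: $S_N$ is the set of permutations of $[N]$ in one-line notation; a transposition $(i,j)$ acts by interchanging the entries $i$ and $j$. $\mathcal{P}^{\mathrm{all}}_N$ is the graph on $S_N$ whose edges join permutations differing by a transposition. A Gray code for $\mathcal{P}^{\mathrm{all}}_N$ is a listing $\pi_1,\dots,\pi_{N!}$ of all of $S_N$ with $\pi_{i+1}$ obtained from $\pi_i$ by a transposition $t_i$; it is cyclic if $\pi_1$ is obtained from $\pi_{N!}$ by a transposition (the closing transposition), and a cyclic Gray code is balanced if, counting the closing transposition, each transposition occurs exactly $2(N-2)!$ times. A transposition $(i,j)$ is adjacent if $|i-j|=1$ and wide otherwise. A Gray code for $\mathcal{P}^{\mathrm{all}}_N$ is almost balanced if every wide transposition occurs exactly $2(N-2)!$ times among $t_1,\dots,t_{N!-1}$. -}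

module Defs where

open import Data.Nat using (ℕ; zero; suc; _∸_; _*_; _<_; _≤_; s≤s; z≤n)
open import Data.Nat using (_!)
open import Data.Fin using (Fin; toℕ; fromℕ<; inject₁; fromℕ; _≟_)
  renaming (zero to fzero; suc to fsuc)
open import Data.Vec using (Vec; lookup; map; tabulate)
open import Data.List using (List; []; _∷_; filter; length)
open import Data.List.Membership.Propositional using (_∈_)
open import Data.List.Relation.Unary.Unique.Propositional using (Unique)
open import Data.Product using (_×_; _,_; proj₁; proj₂)
open import Data.Product.Properties using (≡-dec)
open import Relation.Binary.PropositionalEquality using (_≡_)
open import Relation.Nullary using (Dec; yes; no)

-- A permutation of [N] in one-line notation: a vector of N entries (0-based
-- values in Fin N) whose entries are pairwise distinct.
Perm : ℕ → Set
Perm N = Vec (Fin N) N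

IsPerm : {N : ℕ} → Perm N → Set
IsPerm {N} π = (i j : Fin N) → lookup π i ≡ lookup π j → i ≡ j

Transp : ℕ → Set
Transp N = Fin N × Fin N

ValidT : {N : ℕ} → Transp N → Set
ValidT (i , j) = toℕ i < toℕ j

Wide : {N : ℕ} → Transp N → Set
Wide (i , j) = suc (suc (toℕ i)) ≤ toℕ j

swapVal : {N : ℕ} → Fin N → Fin N → Fin N → Fin N
swapVal i j x with x ≟ i
... | yes _ = j
... | no _ with x ≟ j
...   | yes _ = i
...   | no _ = x

act : {N : ℕ} → Transp N → Perm N → Perm N
act (i , j) π = map (swapVal i j) π

occ : {N : ℕ} → Transp N → List (Transp N) → ℕ
occ t ts = length (filter (λ s → ≡-dec _≟_ _≟_ s t) ts)

data Steps {N : ℕ} : List (Perm N) → List (Transp N) → Set where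
  single : (π : Perm N) → Steps (π ∷ []) []
  step   : (π σ : Perm N) (rest : List (Perm N)) (t : Transp N) (ts : List (Transp N)) →
           ValidT t → σ ≡ act t π → Steps (σ ∷ rest) ts → Steps (π ∷ σ ∷ rest) (t ∷ ts)

First : {A : Set} → List A → A → Set
First [] a = Data.Empty.⊥ where import Data.Empty
First (x ∷ _) a = x ≡ a

Last : {A : Set} → List A → A → Set
Last [] a = Data.Empty.⊥ where import Data.Empty
Last (x ∷ []) a = x ≡ a
Last (_ ∷ y ∷ ys) a = Last (y ∷ ys) a

record GrayCode (N : ℕ) (s e : Perm N) (ts : List (Transp N)) : Set where
  field
    listing  : List (Perm N)
    allPerm  : (π : Perm N) → IsPerm π → π ∈ listing
    onlyPerm : (π : Perm N) → π ∈ listing → IsPerm π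
    unique   : Unique listing
    steps    : Steps listing ts
    first    : First listing s
    last     : Last listing e

AlmostBalanced : (N : ℕ) → List (Transp N) → Set
AlmostBalanced N ts = (t : Transp N) → ValidT t → Wide t → occ t ts ≡ 2 * (N ∸ 2) !

-- Cyclic with closing transposition c: s = act c e, c valid.
-- Balanced: counting c, each transposition occurs exactly 2(N-2)! times.
Balanced : (N : ℕ) → List (Transp N) → Transp N → Set
Balanced N ts c = (t : Transp N) → ValidT t → occ t (c ∷ ts) ≡ 2 * (N ∸ 2) !

idPerm : (N : ℕ) → Perm N
idPerm N = tabulate (λ i → i)

-- 2 3 ⋯ N 1  (0-based: entry at position k is k+1 mod N)
succMod : {N : ℕ} → Fin N → Fin N
succMod {suc zero} fzero = fzero
succMod {suc (suc N)} fzero = fsuc fzero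
succMod {suc (suc N)} (fsuc i) with succMod {suc N} i
... | fzero = fzero
... | fsuc k = fsuc (fsuc k)

rotPerm : (N : ℕ) → Perm N
rotPerm N = tabulate succMod

n∸1<1+n : (n : ℕ) → n ∸ 1 < suc n
n∸1<1+n zero = s≤s z≤n
n∸1<1+n (suc n) = s≤s (go n)
  where
  go : (m : ℕ) → m ≤ suc m
  go zero = z≤n
  go (suc m) = s≤s (go m)

-- the transposition (n, n+1) on [n+1], as 0-based values (n-1, n)
lastTwo : (n : ℕ) → Transp (suc n)
lastTwo n = fromℕ< (n∸1<1+n n) , fromℕ n

swappedId : (n : ℕ) → Perm (suc n)
swappedId n = act (lastTwo n) (idPerm (suc n))

{-# OPTIONS --safe #-}
-- Append n + 1 to every permutation of L and relabel all values cyclically,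
-- v ↦ v + c mod n + 1, for c = 0, …, n.  These n + 1 copies of L are told apart
-- by their last entry, so together they list S_(n+1); consecutive copies are
-- joined by the relabellings of the transposition (1, n + 1), and the last one,
-- (n, n + 1), leads from the end 1 2 ⋯ (n+1) n of the last copy back to the start.
-- Relabelling by all c sends a transposition of gap d exactly once onto each
-- transposition of gap d and each one of gap n + 1 − d.  So a transposition of
-- gap e occurs G e + G (n + 1 − e) times, where G counts the gaps in L plus one
-- bridge of gap n.  Almost balancedness gives G d = 2 (n−2)! (n−d) for wide d,
-- the length n! − 1 of L then gives G 1 = 2 (n−1)! − 1, and G n = 1; every such
-- sum is 2 (n−1)!.
module Submission where

open import Defs
open import Data.Fin using (Fin; toℕ; fromℕ; fromℕ<; inject₁; lower₁)
import Data.Fin as Fin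
import Data.Fin.Properties as Finₚ
open import Data.Fin.Relation.Unary.Top using (view; ‵fromℕ; ‵inject₁)
open import Data.List using (List; []; _∷_; _++_; map; length)
import Data.List.Properties as Listₚ
open import Data.List.Membership.Propositional using (_∈_)
open import Data.List.Membership.Propositional.Properties using (∈-map⁺; ∈-map⁻; ∈-++⁺ˡ; ∈-++⁺ʳ; ∈-++⁻)
open import Data.List.Membership.Propositional.Properties.WithK using (unique∧set⇒bag)
open import Data.List.Relation.Binary.BagAndSetEquality using (∼bag⇒↭)
open import Data.List.Relation.Binary.Permutation.Propositional.Properties using (↭-length)
open import Data.List.Relation.Unary.All using (All; []; _∷_)
import Data.List.Relation.Unary.AllPairs as AllPairs
open import Data.List.Relation.Unary.Any using (here)
open import Data.List.Relation.Unary.Unique.Propositional using (Unique)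
import Data.List.Relation.Unary.Unique.Propositional.Properties as Uniqueₚ
open import Data.Nat using (ℕ; zero; suc; _+_; _*_; _∸_; _≤_; _<_; s≤s; z≤n; _!)
import Data.Nat as ℕ
import Data.Nat.Properties as ℕₚ
open import Data.Nat.DivMod using (_%_; _mod_; n%n≡0; %-distribˡ-+; m%n%n≡m%n; [m+n]%n≡m%n; m<n⇒m%n≡m; m%n≤n)
open import Data.Nat.Divisibility using (_∣_; ∣1⇒≡1)
open import Data.Nat.Tactic.RingSolver using (solve-∀)
open import Algebra.Properties.CommutativeSemigroup ℕₚ.+-commutativeSemigroup
  using () renaming (interchange to +-interchange; x∙yz≈y∙xz to x+[y+z]≡y+[x+z])
open import Algebra.Properties.CommutativeSemigroup ℕₚ.*-commutativeSemigroup
  using () renaming (x∙yz≈y∙xz to x*[y*z]≡y*[x*z])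
open import Data.Product using (Σ; _×_; _,_; proj₁; proj₂)
open import Data.Product.Properties using (≡-dec)
open import Data.Sum using (_⊎_; inj₁; inj₂)
open import Data.Sum.Function.Propositional using (_⊎-⇔_)
open import Data.Vec using (Vec; lookup; tabulate; _∷ʳ_)
import Data.Vec as Vec
import Data.Vec.Properties as Vecₚ
open import Function using (id; _∘_)
open import Function.Bundles using (_⇔_; mk⇔; Equivalence)
open import Function.Properties.Equivalence using () renaming (trans to ⇔-trans)
open import Relation.Binary.PropositionalEquality
  using (_≡_; _≢_; refl; sym; trans; cong; cong₂; subst; subst₂; module ≡-Reasoning)
open import Relation.Nullary using (¬_; Dec; yes; no; contradiction; _×-dec_; _⊎-dec_)

𝟙 : {P : Set} → Dec P → ℕ
𝟙 (yes _) = 1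
𝟙 (no _)  = 0

𝟙-yes : {P : Set} (p? : Dec P) → P → 𝟙 p? ≡ 1
𝟙-yes (yes _) _ = refl
𝟙-yes (no ¬p) p = contradiction p ¬p

𝟙-no : {P : Set} (p? : Dec P) → ¬ P → 𝟙 p? ≡ 0
𝟙-no (yes p) ¬p = contradiction p ¬p
𝟙-no (no _)  _  = refl

𝟙-cong : {P Q : Set} → P ⇔ Q → (p? : Dec P) (q? : Dec Q) → 𝟙 p? ≡ 𝟙 q?
𝟙-cong P⇔Q p? (yes q) = 𝟙-yes p? (Equivalence.from P⇔Q q)
𝟙-cong P⇔Q p? (no ¬q) = 𝟙-no p? (¬q ∘ Equivalence.to P⇔Q)

𝟙-× : {P Q : Set} (p? : Dec P) (q? : Dec Q) → 𝟙 (p? ×-dec q?) ≡ 𝟙 p? * 𝟙 q?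
𝟙-× (yes _) (yes _) = refl
𝟙-× (yes _) (no _)  = refl
𝟙-× (no _)  _       = refl

𝟙-⊎ : {P Q : Set} → ¬ (P × Q) → (p? : Dec P) (q? : Dec Q) → 𝟙 (p? ⊎-dec q?) ≡ 𝟙 p? + 𝟙 q?
𝟙-⊎ ¬both (yes p) (yes q) = contradiction (p , q) ¬both
𝟙-⊎ ¬both (yes _) (no _)  = refl
𝟙-⊎ ¬both (no _)  (yes _) = refl
𝟙-⊎ ¬both (no _)  (no _)  = refl

𝟙-sym : ∀ a b → 𝟙 (a ℕ.≟ b) ≡ 𝟙 (b ℕ.≟ a)
𝟙-sym a b = 𝟙-cong (mk⇔ sym sym) (a ℕ.≟ b) (b ℕ.≟ a)

∑< : ℕ → (ℕ → ℕ) → ℕ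
∑< zero    f = 0
∑< (suc n) f = ∑< n f + f n

syntax ∑< n (λ k → e) = ∑[ k < n ] e

∑<-cong : ∀ n {f g : ℕ → ℕ} → (∀ k → k < n → f k ≡ g k) → ∑< n f ≡ ∑< n g
∑<-cong zero    f≗g = refl
∑<-cong (suc n) f≗g = cong₂ _+_ (∑<-cong n (λ k k<n → f≗g k (ℕₚ.m<n⇒m<1+n k<n))) (f≗g n ℕₚ.≤-refl)

∑<-+ : ∀ n (f g : ℕ → ℕ) → ∑[ k < n ] (f k + g k) ≡ ∑< n f + ∑< n g
∑<-+ zero    f g = refl
∑<-+ (suc n) f g = trans (cong (_+ (f n + g n)) (∑<-+ n f g)) (+-interchange (∑< n f) (∑< n g) (f n) (g n))

∑<-*ʳ : ∀ n (f : ℕ → ℕ) c → ∑[ k < n ] (f k * c) ≡ ∑< n f * c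
∑<-*ʳ zero    f c = refl
∑<-*ʳ (suc n) f c = trans (cong (_+ f n * c) (∑<-*ʳ n f c)) (sym (ℕₚ.*-distribʳ-+ c (∑< n f) (f n)))

∑<-const : ∀ n c → ∑[ k < n ] c ≡ n * c
∑<-const zero    c = refl
∑<-const (suc n) c = trans (cong (_+ c) (∑<-const n c)) (ℕₚ.+-comm (n * c) c)

∑<-suc : ∀ n (f : ℕ → ℕ) → ∑< (suc n) f ≡ f 0 + ∑[ k < n ] f (suc k)
∑<-suc zero    f = ℕₚ.+-comm 0 (f 0)
∑<-suc (suc n) f = trans (cong (_+ f (suc n)) (∑<-suc n f)) (ℕₚ.+-assoc (f 0) _ _)

∑<-zero : ∀ n {f : ℕ → ℕ} → (∀ k → k < n → f k ≡ 0) → ∑< n f ≡ 0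
∑<-zero n f≗0 = trans (∑<-cong n f≗0) (trans (∑<-const n 0) (ℕₚ.*-zeroʳ n))

∑<-δ : ∀ n {a} → a < n → ∑[ k < n ] 𝟙 (k ℕ.≟ a) ≡ 1
∑<-δ (suc n) {a} a<1+n with a ℕ.≟ n
... | yes refl = cong₂ _+_ (∑<-zero n λ k k<n → 𝟙-no (k ℕ.≟ a) (ℕₚ.<⇒≢ k<n)) (𝟙-yes (n ℕ.≟ n) refl)
... | no a≢n   = cong₂ _+_ (∑<-δ n (ℕₚ.≤∧≢⇒< (ℕ.s≤s⁻¹ a<1+n) a≢n)) (𝟙-no (n ℕ.≟ a) (a≢n ∘ sym))

∑<-δ* : ∀ n {a} c → a < n → ∑[ k < n ] (𝟙 (k ℕ.≟ a) * c) ≡ c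
∑<-δ* n c a<n = trans (∑<-*ʳ n _ c) (trans (cong (_* c) (∑<-δ n a<n)) (ℕₚ.*-identityˡ c))

∑∈ : {A : Set} → List A → (A → ℕ) → ℕ
∑∈ []       f = 0
∑∈ (x ∷ xs) f = f x + ∑∈ xs f

syntax ∑∈ xs (λ x → e) = ∑[ x ∈ xs ] e

module _ {A : Set} where

  ∑∈-cong : {P : A → Set} {xs : List A} {f g : A → ℕ} → All P xs → (∀ {x} → P x → f x ≡ g x) → ∑∈ xs f ≡ ∑∈ xs g
  ∑∈-cong []         f≗g = refl
  ∑∈-cong (px ∷ pxs) f≗g = cong₂ _+_ (f≗g px) (∑∈-cong pxs f≗g)

  ∑∈-++ : (xs ys : List A) (f : A → ℕ) → ∑∈ (xs ++ ys) f ≡ ∑∈ xs f + ∑∈ ys f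
  ∑∈-++ []       ys f = refl
  ∑∈-++ (x ∷ xs) ys f = trans (cong (f x +_) (∑∈-++ xs ys f)) (sym (ℕₚ.+-assoc (f x) _ _))

  ∑∈-map : {B : Set} (g : B → A) (xs : List B) (f : A → ℕ) → ∑∈ (map g xs) f ≡ ∑[ x ∈ xs ] f (g x)
  ∑∈-map g []       f = refl
  ∑∈-map g (x ∷ xs) f = cong (f (g x) +_) (∑∈-map g xs f)

  ∑∈-+ : (xs : List A) (f g : A → ℕ) → ∑[ x ∈ xs ] (f x + g x) ≡ ∑∈ xs f + ∑∈ xs g
  ∑∈-+ []       f g = refl
  ∑∈-+ (x ∷ xs) f g = trans (cong (f x + g x +_) (∑∈-+ xs f g)) (+-interchange (f x) (g x) _ _)

  ∑∈-1 : (xs : List A) → ∑[ x ∈ xs ] 1 ≡ length xs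
  ∑∈-1 []       = refl
  ∑∈-1 (x ∷ xs) = cong suc (∑∈-1 xs)

  ∑∈-0 : (xs : List A) → ∑[ x ∈ xs ] 0 ≡ 0
  ∑∈-0 []       = refl
  ∑∈-0 (x ∷ xs) = ∑∈-0 xs

  ∑-comm : ∀ n (xs : List A) (g : ℕ → A → ℕ) → ∑[ k < n ] ∑∈ xs (g k) ≡ ∑[ x ∈ xs ] ∑[ k < n ] g k x
  ∑-comm zero    xs g = sym (∑∈-0 xs)
  ∑-comm (suc n) xs g = trans (cong (_+ ∑∈ xs (g n)) (∑-comm n xs g)) (sym (∑∈-+ xs (λ x → ∑[ k < n ] g k x) (g n)))

-- Counting transpositions by gap

_≟ₜ_ : {N : ℕ} (s t : Transp N) → Dec (s ≡ t)
_≟ₜ_ = ≡-dec Fin._≟_ Fin._≟_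

occ-∑ : {N : ℕ} (t : Transp N) (xs : List (Transp N)) → occ t xs ≡ ∑[ s ∈ xs ] 𝟙 (s ≟ₜ t)
occ-∑ t []       = refl
occ-∑ t (s ∷ xs) with s ≟ₜ t
... | yes _ = cong suc (occ-∑ t xs)
... | no _  = occ-∑ t xs

gap : {N : ℕ} → Transp N → ℕ
gap (i , j) = toℕ j ∸ toℕ i

gapCount : {N : ℕ} → List (Transp N) → ℕ → ℕ
gapCount ts d = ∑[ s ∈ ts ] 𝟙 (gap s ℕ.≟ d)

gap<N : {N : ℕ} (s : Transp N) → gap s < N
gap<N (i , j) = ℕₚ.≤-<-trans (ℕₚ.m∸n≤m (toℕ j) (toℕ i)) (Finₚ.toℕ<n j)

module _ {N : ℕ} {ts : List (Transp N)} (valid : All ValidT ts) where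

  gapCount-0 : gapCount ts 0 ≡ 0
  gapCount-0 = trans (∑∈-cong valid λ {s} v → 𝟙-no (gap s ℕ.≟ 0) (ℕₚ.>⇒≢ (ℕₚ.m<n⇒0<n∸m v))) (∑∈-0 ts)

  gapCount-≥ : ∀ {d} → N ≤ d → gapCount ts d ≡ 0
  gapCount-≥ {d} N≤d = trans (∑∈-cong valid λ {s} _ → 𝟙-no (gap s ℕ.≟ d) (ℕₚ.<⇒≢ (ℕₚ.<-≤-trans (gap<N s) N≤d))) (∑∈-0 ts)

  length≡∑gapCount : length ts ≡ ∑[ d < N ] gapCount ts d
  length≡∑gapCount = begin
    length ts                              ≡⟨ ∑∈-1 ts ⟨
    ∑[ s ∈ ts ] 1                          ≡⟨ ∑∈-cong valid (λ {s} _ → ∑<-δ N (gap<N s)) ⟨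
    ∑[ s ∈ ts ] ∑[ d < N ] 𝟙 (d ℕ.≟ gap s) ≡⟨ ∑∈-cong valid (λ {s} _ → ∑<-cong N λ d _ → 𝟙-sym d (gap s)) ⟩
    ∑[ s ∈ ts ] ∑[ d < N ] 𝟙 (gap s ℕ.≟ d) ≡⟨ ∑-comm N ts (λ d s → 𝟙 (gap s ℕ.≟ d)) ⟨
    ∑[ d < N ] gapCount ts d               ∎
    where open ≡-Reasoning

𝟙-≟ₜ : {N : ℕ} (i j x y : Fin N) {a b : ℕ} → toℕ x ≡ a → toℕ y ≡ b →
       𝟙 ((i , j) ≟ₜ (x , y)) ≡ 𝟙 (toℕ i ℕ.≟ a) * 𝟙 (toℕ j ℕ.≟ b)
𝟙-≟ₜ i j x y refl refl =
  trans (𝟙-cong (mk⇔ to from) ((i , j) ≟ₜ (x , y)) (toℕ i ℕ.≟ toℕ x ×-dec toℕ j ℕ.≟ toℕ y))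
        (𝟙-× (toℕ i ℕ.≟ toℕ x) (toℕ j ℕ.≟ toℕ y))
  where
  to : (i , j) ≡ (x , y) → toℕ i ≡ toℕ x × toℕ j ≡ toℕ y
  to refl = refl , refl
  from : toℕ i ≡ toℕ x × toℕ j ≡ toℕ y → (i , j) ≡ (x , y)
  from (i≡x , j≡y) = cong₂ _,_ (Finₚ.toℕ-injective i≡x) (Finₚ.toℕ-injective j≡y)

𝟙-gap-term : ∀ {i j} a d → i ≤ j → 𝟙 (i ℕ.≟ a) * 𝟙 (j ℕ.≟ a + d) ≡ 𝟙 (a ℕ.≟ i) * 𝟙 (j ∸ i ℕ.≟ d)
𝟙-gap-term {i} {j} a d i≤j =
  trans (sym (𝟙-× (i ℕ.≟ a) (j ℕ.≟ a + d))) (trans (𝟙-cong (mk⇔ to from) _ _) (𝟙-× (a ℕ.≟ i) (j ∸ i ℕ.≟ d)))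
  where
  to : i ≡ a × j ≡ a + d → a ≡ i × j ∸ i ≡ d
  to (i≡a , j≡a+d) = sym i≡a , trans (cong₂ _∸_ j≡a+d i≡a) (ℕₚ.m+n∸m≡n a d)
  from : a ≡ i × j ∸ i ≡ d → i ≡ a × j ≡ a + d
  from (a≡i , j∸i≡d) = sym a≡i , trans (sym (ℕₚ.m+[n∸m]≡n i≤j)) (cong₂ _+_ (sym a≡i) j∸i≡d)

𝟙-gap : ∀ N {i j} d → i < j → j < N → 𝟙 (j ∸ i ℕ.≟ d) ≡ ∑[ a < N ∸ d ] (𝟙 (i ℕ.≟ a) * 𝟙 (j ℕ.≟ a + d))
𝟙-gap N {i} {j} d i<j j<N = sym (begin
  ∑[ a < N ∸ d ] (𝟙 (i ℕ.≟ a) * 𝟙 (j ℕ.≟ a + d))   ≡⟨ ∑<-cong (N ∸ d) (λ a _ → 𝟙-gap-term a d (ℕₚ.<⇒≤ i<j)) ⟩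
  ∑[ a < N ∸ d ] (𝟙 (a ℕ.≟ i) * 𝟙 (j ∸ i ℕ.≟ d))  ≡⟨ ∑<-*ʳ (N ∸ d) (λ a → 𝟙 (a ℕ.≟ i)) _ ⟩
  (∑[ a < N ∸ d ] 𝟙 (a ℕ.≟ i)) * 𝟙 (j ∸ i ℕ.≟ d)  ≡⟨ at-most-one (j ∸ i ℕ.≟ d) ⟩
  𝟙 (j ∸ i ℕ.≟ d)                                 ∎)
  where
  open ≡-Reasoning
  at-most-one : (g? : Dec (j ∸ i ≡ d)) → (∑[ a < N ∸ d ] 𝟙 (a ℕ.≟ i)) * 𝟙 g? ≡ 𝟙 g?
  at-most-one (yes j∸i≡d) = cong (_* 1) (∑<-δ (N ∸ d) (ℕₚ.m+n≤o⇒m≤o∸n (suc i) i+d<N))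
    where
    i+d<N : i + d < N
    i+d<N = subst (_< N) (trans (sym (ℕₚ.m+[n∸m]≡n (ℕₚ.<⇒≤ i<j))) (cong (i +_) j∸i≡d)) j<N
  at-most-one (no _) = ℕₚ.*-zeroʳ (∑[ a < N ∸ d ] 𝟙 (a ℕ.≟ i))

module _ {N : ℕ} {ts : List (Transp N)} (valid : All ValidT ts) (balanced : AlmostBalanced N ts) where

  gapCount-wide : ∀ {d} → 2 ≤ d → d < N → gapCount ts d ≡ (N ∸ d) * (2 * (N ∸ 2) !)
  gapCount-wide {d} 2≤d d<N = begin
    gapCount ts d                     ≡⟨ ∑∈-cong valid (λ { {i , j} i<j → 𝟙-gap N d i<j (Finₚ.toℕ<n j) }) ⟩
    ∑[ s ∈ ts ] ∑[ a < N ∸ d ] hits a s ≡⟨ ∑-comm (N ∸ d) ts hits ⟨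
    ∑[ a < N ∸ d ] ∑∈ ts (hits a)     ≡⟨ ∑<-cong (N ∸ d) occurrences ⟩
    ∑[ a < N ∸ d ] (2 * (N ∸ 2) !)    ≡⟨ ∑<-const (N ∸ d) _ ⟩
    (N ∸ d) * (2 * (N ∸ 2) !)         ∎
    where
    open ≡-Reasoning
    hits : ℕ → Transp N → ℕ
    hits a (i , j) = 𝟙 (toℕ i ℕ.≟ a) * 𝟙 (toℕ j ℕ.≟ a + d)
    occurrences : ∀ a → a < N ∸ d → ∑∈ ts (hits a) ≡ 2 * (N ∸ 2) !
    occurrences a a<N∸d = begin
      ∑∈ ts (hits a)         ≡⟨ ∑∈-cong valid (λ { {i , j} _ → 𝟙-≟ₜ i j x y (Finₚ.toℕ-fromℕ< a<N) (Finₚ.toℕ-fromℕ< a+d<N) }) ⟨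
      ∑[ s ∈ ts ] 𝟙 (s ≟ₜ t) ≡⟨ occ-∑ t ts ⟨
      occ t ts               ≡⟨ balanced t valid-t wide-t ⟩
      2 * (N ∸ 2) !          ∎
      where
      a+d<N : a + d < N
      a+d<N = ℕₚ.m≤o∸n⇒m+n≤o (suc a) (ℕₚ.<⇒≤ d<N) a<N∸d
      a<N : a < N
      a<N = ℕₚ.≤-<-trans (ℕₚ.m≤m+n a d) a+d<N
      x y : Fin N
      x = fromℕ< a<N
      y = fromℕ< a+d<N
      t : Transp N
      t = x , y
      wide-t : Wide t
      wide-t = subst₂ (λ u v → 2 + u ≤ v) (sym (Finₚ.toℕ-fromℕ< a<N)) (sym (Finₚ.toℕ-fromℕ< a+d<N))
                      (subst (_≤ a + d) (ℕₚ.+-comm a 2) (ℕₚ.+-monoʳ-≤ a 2≤d))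
      valid-t : ValidT t
      valid-t = ℕₚ.<-≤-trans (ℕₚ.n<1+n _) (ℕₚ.<⇒≤ wide-t)

triangular : ∀ p → 2 * ∑[ k < p ] (p ∸ k) ≡ p * suc p
triangular zero    = refl
triangular (suc p) = begin
  2 * (∑[ k < p ] (suc p ∸ k) + (suc p ∸ p))
    ≡⟨ cong₂ (λ x y → 2 * (x + y)) (∑<-cong p λ k k<p → ℕₚ.+-∸-assoc 1 (ℕₚ.<⇒≤ k<p)) (ℕₚ.m+n∸n≡m 1 p) ⟩
  2 * (∑[ k < p ] (1 + (p ∸ k)) + 1)
    ≡⟨ cong (λ x → 2 * (x + 1)) (trans (∑<-+ p (λ _ → 1) (p ∸_)) (cong (_+ T) (trans (∑<-const p 1) (ℕₚ.*-identityʳ p)))) ⟩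
  2 * (p + T + 1)      ≡⟨ regroup p T ⟩
  2 * T + 2 * suc p    ≡⟨ cong (_+ 2 * suc p) (triangular p) ⟩
  p * suc p + 2 * suc p ≡⟨ close p ⟩
  suc p * suc (suc p)  ∎
  where
  open ≡-Reasoning
  T = ∑[ k < p ] (p ∸ k)
  regroup : ∀ p T → 2 * (p + T + 1) ≡ 2 * T + 2 * suc p
  regroup = solve-∀
  close : ∀ p → p * suc p + 2 * suc p ≡ suc p * suc (suc p)
  close = solve-∀

complementary-gaps : ∀ n {e} → 1 ≤ e → e < n → (n ∸ e) + (n ∸ (suc n ∸ e)) ≡ n ∸ 1
complementary-gaps (suc n) {suc e} _ (s≤s e<n) = begin
  (n ∸ e) + (suc n ∸ (suc n ∸ e)) ≡⟨ cong (λ x → (n ∸ e) + (suc n ∸ x)) (ℕₚ.+-∸-assoc 1 (ℕₚ.<⇒≤ e<n)) ⟩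
  (n ∸ e) + (n ∸ (n ∸ e))         ≡⟨ cong ((n ∸ e) +_) (ℕₚ.m∸[m∸n]≡n (ℕₚ.<⇒≤ e<n)) ⟩
  (n ∸ e) + e                     ≡⟨ ℕₚ.m∸n+n≡m (ℕₚ.<⇒≤ e<n) ⟩
  n                               ∎
  where open ≡-Reasoning

-- The gap count of ts followed by one more transposition, of gap N: the bridge (1 , N + 1) between copies.
closedGapCount : {N : ℕ} → List (Transp N) → ℕ → ℕ
closedGapCount {N} ts d = gapCount ts d + 𝟙 (N ℕ.≟ d)

module _ {p : ℕ} {ts : List (Transp (2 + p))} (valid : All ValidT ts) (balanced : AlmostBalanced (2 + p) ts)
         (length-ts : suc (length ts) ≡ (2 + p) !) where

  -- The adjacent transpositions are what the wide ones leave of the n! - 1 steps.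
  gapCount-adjacent : gapCount ts 1 + 1 ≡ 2 * (suc p) !
  gapCount-adjacent = ℕₚ.+-cancelʳ-≡ (T * W) _ _ (begin
    gapCount ts 1 + 1 + T * W    ≡⟨ shuffle (gapCount ts 1) (T * W) ⟩
    suc (gapCount ts 1 + T * W)  ≡⟨ cong suc length≡ ⟨
    suc (length ts)              ≡⟨ length-ts ⟩
    (2 + p) !                    ≡⟨ factorial-split ⟩
    2 * (suc p) ! + T * W        ∎)
    where
    open ≡-Reasoning
    W = 2 * p !
    T = ∑[ k < p ] (p ∸ k)
    shuffle : ∀ a b → a + 1 + b ≡ suc (a + b)
    shuffle = solve-∀
    length≡ : length ts ≡ gapCount ts 1 + T * W
    length≡ = begin
      length ts                                          ≡⟨ length≡∑gapCount valid ⟩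
      ∑[ d < 2 + p ] gapCount ts d                       ≡⟨ ∑<-suc (suc p) (gapCount ts) ⟩
      gapCount ts 0 + ∑[ d < suc p ] gapCount ts (suc d) ≡⟨ cong₂ _+_ (gapCount-0 valid) (∑<-suc p _) ⟩
      gapCount ts 1 + ∑[ k < p ] gapCount ts (2 + k)     ≡⟨ cong (gapCount ts 1 +_) (∑<-cong p wide) ⟩
      gapCount ts 1 + ∑[ k < p ] ((p ∸ k) * W)           ≡⟨ cong (gapCount ts 1 +_) (∑<-*ʳ p (p ∸_) W) ⟩
      gapCount ts 1 + T * W                              ∎
      where
      wide : ∀ k → k < p → gapCount ts (2 + k) ≡ (p ∸ k) * W
      wide k k<p = gapCount-wide valid balanced (s≤s (s≤s z≤n)) (s≤s (s≤s k<p))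
    factorial-split : (2 + p) ! ≡ 2 * (suc p) ! + T * W
    factorial-split = begin
      (2 + p) !                        ≡⟨ expand p (p !) ⟩
      2 * (suc p) ! + p * suc p * p !  ≡⟨ cong (λ x → 2 * (suc p) ! + x * p !) (triangular p) ⟨
      2 * (suc p) ! + 2 * T * p !      ≡⟨ cong (2 * (suc p) ! +_) (reassoc T (p !)) ⟩
      2 * (suc p) ! + T * W            ∎
      where
      expand : ∀ p f → (2 + p) * (suc p * f) ≡ 2 * (suc p * f) + p * suc p * f
      expand = solve-∀
      reassoc : ∀ T f → 2 * T * f ≡ T * (2 * f)
      reassoc = solve-∀

  closedGapCount-ends : closedGapCount ts 1 + closedGapCount ts (2 + p) ≡ 2 * (suc p) !
  closedGapCount-ends = begin
    gapCount ts 1 + 𝟙 (2 + p ℕ.≟ 1) + (gapCount ts (2 + p) + 𝟙 (2 + p ℕ.≟ 2 + p))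
      ≡⟨ cong₂ _+_ (cong (gapCount ts 1 +_) (𝟙-no (2 + p ℕ.≟ 1) λ ()))
                   (cong₂ _+_ (gapCount-≥ valid ℕₚ.≤-refl) (𝟙-yes (2 + p ℕ.≟ 2 + p) refl)) ⟩
    gapCount ts 1 + 0 + 1 ≡⟨ cong (_+ 1) (ℕₚ.+-identityʳ (gapCount ts 1)) ⟩
    gapCount ts 1 + 1     ≡⟨ gapCount-adjacent ⟩
    2 * (suc p) !         ∎
    where open ≡-Reasoning

  closedGapCount-wide : ∀ {e} → 2 ≤ e → e < 2 + p → closedGapCount ts e + closedGapCount ts (3 + p ∸ e) ≡ 2 * (suc p) !
  closedGapCount-wide {e} 2≤e e<n = begin
    gapCount ts e + 𝟙 (2 + p ℕ.≟ e) + (gapCount ts e′ + 𝟙 (2 + p ℕ.≟ e′))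
      ≡⟨ cong₂ _+_ (cong₂ _+_ (gapCount-wide valid balanced 2≤e e<n) (𝟙-no (2 + p ℕ.≟ e) (ℕₚ.>⇒≢ e<n)))
                   (cong₂ _+_ (gapCount-wide valid balanced 2≤e′ e′<n) (𝟙-no (2 + p ℕ.≟ e′) (ℕₚ.>⇒≢ e′<n))) ⟩
    (2 + p ∸ e) * W + 0 + ((2 + p ∸ e′) * W + 0)
      ≡⟨ cong₂ _+_ (ℕₚ.+-identityʳ ((2 + p ∸ e) * W)) (ℕₚ.+-identityʳ ((2 + p ∸ e′) * W)) ⟩
    (2 + p ∸ e) * W + (2 + p ∸ e′) * W
      ≡⟨ ℕₚ.*-distribʳ-+ W (2 + p ∸ e) (2 + p ∸ e′) ⟨
    ((2 + p ∸ e) + (2 + p ∸ e′)) * W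
      ≡⟨ cong (_* W) (complementary-gaps (2 + p) (ℕₚ.<⇒≤ 2≤e) e<n) ⟩
    suc p * (2 * p !)
      ≡⟨ x*[y*z]≡y*[x*z] (suc p) 2 (p !) ⟩
    2 * (suc p) ! ∎
    where
    open ≡-Reasoning
    W = 2 * p !
    e′ = 3 + p ∸ e
    2≤e′ : 2 ≤ e′
    2≤e′ = subst (2 ≤_) (sym (ℕₚ.+-∸-assoc 1 (ℕₚ.<⇒≤ e<n))) (s≤s (ℕₚ.m<n⇒0<n∸m e<n))
    e′<n : e′ < 2 + p
    e′<n = ℕₚ.m<n+o⇒m∸n<o (3 + p) e
             (subst₂ _<_ (ℕₚ.+-comm (2 + p) 1) (ℕₚ.+-comm (2 + p) e) (ℕₚ.+-monoʳ-< (2 + p) 2≤e))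

  closedGapCount-complementary : ∀ {e} → 1 ≤ e → e ≤ 2 + p →
                                 closedGapCount ts e + closedGapCount ts (3 + p ∸ e) ≡ 2 * (suc p) !
  closedGapCount-complementary {e} 1≤e e≤n with e ℕ.≟ 1 | e ℕ.≟ 2 + p
  ... | yes refl | _        = closedGapCount-ends
  ... | no _     | yes refl = begin
    G (2 + p) + G (3 + p ∸ (2 + p)) ≡⟨ cong (λ d → G (2 + p) + G d) (ℕₚ.m+n∸n≡m 1 (2 + p)) ⟩
    G (2 + p) + G 1                 ≡⟨ ℕₚ.+-comm (G (2 + p)) (G 1) ⟩
    G 1 + G (2 + p)                 ≡⟨ closedGapCount-ends ⟩
    2 * (suc p) !                   ∎
    where
    open ≡-Reasoning
    G = closedGapCount ts
  ... | no e≢1   | no e≢n   = closedGapCount-wide (ℕₚ.≤∧≢⇒< 1≤e (e≢1 ∘ sym)) (ℕₚ.≤∧≢⇒< e≤n e≢n)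

module _ {A : Set} where

  lookup-extensionality : ∀ {k} {u v : Vec A k} → (∀ i → lookup u i ≡ lookup v i) → u ≡ v
  lookup-extensionality {u = u} {v} u≗v =
    trans (sym (Vecₚ.tabulate∘lookup u)) (trans (Vecₚ.tabulate-cong u≗v) (Vecₚ.tabulate∘lookup v))

  lookup-∷ʳ-last : ∀ {k} (v : Vec A k) x → lookup (v ∷ʳ x) (fromℕ k) ≡ x
  lookup-∷ʳ-last Vec.[]      x = refl
  lookup-∷ʳ-last (y Vec.∷ v) x = lookup-∷ʳ-last v x

  lookup-∷ʳ-inject₁ : ∀ {k} (v : Vec A k) x i → lookup (v ∷ʳ x) (inject₁ i) ≡ lookup v i
  lookup-∷ʳ-inject₁ (y Vec.∷ v) x Fin.zero    = refl
  lookup-∷ʳ-inject₁ (y Vec.∷ v) x (Fin.suc i) = lookup-∷ʳ-inject₁ v x i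

  map-injective : {B : Set} {f : A → B} → (∀ {x y} → f x ≡ f y → x ≡ y) →
                  ∀ {k} {u v : Vec A k} → Vec.map f u ≡ Vec.map f v → u ≡ v
  map-injective f-inj {u = Vec.[]}    {Vec.[]}    eq = refl
  map-injective f-inj {u = x Vec.∷ u} {y Vec.∷ v} eq =
    cong₂ Vec._∷_ (f-inj (Vecₚ.∷-injectiveˡ eq)) (map-injective f-inj (Vecₚ.∷-injectiveʳ eq))

swapVal-elim : {N : ℕ} (i j x : Fin N) (P : Fin N → Set) →
  (x ≡ i → P j) → (x ≡ j → P i) → (x ≢ i → x ≢ j → P x) → P (swapVal i j x)
swapVal-elim i j x P at-i at-j elsewhere with x Fin.≟ i
... | yes x≡i = at-i x≡i
... | no x≢i with x Fin.≟ j
...   | yes x≡j = at-j x≡j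
...   | no x≢j  = elsewhere x≢i x≢j

swapVal-left : {N : ℕ} (i j : Fin N) → swapVal i j i ≡ j
swapVal-left i j = swapVal-elim i j i (_≡ j) (λ _ → refl) id (λ i≢i _ → contradiction refl i≢i)

swapVal-right : {N : ℕ} (i j : Fin N) → swapVal i j j ≡ i
swapVal-right i j = swapVal-elim i j j (_≡ i) id (λ _ → refl) (λ _ j≢j → contradiction refl j≢j)

swapVal-other : {N : ℕ} (i j x : Fin N) → x ≢ i → x ≢ j → swapVal i j x ≡ x
swapVal-other i j x x≢i x≢j = swapVal-elim i j x (_≡ x) (contradiction′ x≢i) (contradiction′ x≢j) (λ _ _ → refl)
  where
  contradiction′ : ∀ {y z} → x ≢ y → x ≡ y → z ≡ x
  contradiction′ x≢y x≡y = contradiction x≡y x≢y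

swapVal-comm : {N : ℕ} (i j x : Fin N) → swapVal i j x ≡ swapVal j i x
swapVal-comm i j x = swapVal-elim i j x (_≡ swapVal j i x)
  (λ { refl → sym (swapVal-right j x) })
  (λ { refl → sym (swapVal-left x i) })
  (λ x≢i x≢j → sym (swapVal-other j i x x≢j x≢i))

swapVal-involutive : {N : ℕ} (i j x : Fin N) → swapVal i j (swapVal i j x) ≡ x
swapVal-involutive i j x = swapVal-elim i j x (λ y → swapVal i j y ≡ x)
  (λ { refl → swapVal-right x j })
  (λ { refl → swapVal-left i x })
  (swapVal-other i j x)

swapVal-natural : {N M : ℕ} (f : Fin N → Fin M) → (∀ {x y} → f x ≡ f y → x ≡ y) →
  (i j x : Fin N) → f (swapVal i j x) ≡ swapVal (f i) (f j) (f x)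
swapVal-natural f f-inj i j x = swapVal-elim i j x (λ y → f y ≡ swapVal (f i) (f j) (f x))
  (λ { refl → sym (swapVal-left (f x) (f j)) })
  (λ { refl → sym (swapVal-right (f i) (f x)) })
  (λ x≢i x≢j → sym (swapVal-other (f i) (f j) (f x) (x≢i ∘ f-inj) (x≢j ∘ f-inj)))

act-involutive : {N : ℕ} (t : Transp N) (π : Perm N) → act t (act t π) ≡ π
act-involutive (i , j) π = begin
  Vec.map (swapVal i j) (Vec.map (swapVal i j) π) ≡⟨ Vecₚ.map-∘ (swapVal i j) (swapVal i j) π ⟨
  Vec.map (swapVal i j ∘ swapVal i j) π           ≡⟨ Vecₚ.map-cong (swapVal-involutive i j) π ⟩
  Vec.map id π                                    ≡⟨ Vecₚ.map-id π ⟩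
  π                                               ∎
  where open ≡-Reasoning

transp : {N : ℕ} → Fin N → Fin N → Transp N
transp a b with toℕ a ℕ.<? toℕ b
... | yes _ = a , b
... | no _  = b , a

module _ {N : ℕ} where

  act-transp : (a b : Fin N) (π : Perm N) → act (transp a b) π ≡ Vec.map (swapVal a b) π
  act-transp a b π with toℕ a ℕ.<? toℕ b
  ... | yes _ = refl
  ... | no _  = Vecₚ.map-cong (swapVal-comm b a) π

  transp-valid : {a b : Fin N} → a ≢ b → ValidT (transp a b)
  transp-valid {a} {b} a≢b with toℕ a ℕ.<? toℕ b
  ... | yes a<b = a<b
  ... | no a≮b  = ℕₚ.≤∧≢⇒< (ℕₚ.≮⇒≥ a≮b) (a≢b ∘ sym ∘ Finₚ.toℕ-injective)

  transp-≡ : {a b x y : Fin N} → toℕ x < toℕ y → transp a b ≡ (x , y) ⇔ ((a ≡ x × b ≡ y) ⊎ (a ≡ y × b ≡ x))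
  transp-≡ {a} {b} {x} {y} x<y = mk⇔ to from
    where
    to : transp a b ≡ (x , y) → (a ≡ x × b ≡ y) ⊎ (a ≡ y × b ≡ x)
    to eq with toℕ a ℕ.<? toℕ b
    to refl | yes _ = inj₁ (refl , refl)
    to refl | no _  = inj₂ (refl , refl)
    from : (a ≡ x × b ≡ y) ⊎ (a ≡ y × b ≡ x) → transp a b ≡ (x , y)
    from (inj₁ (refl , refl)) with toℕ a ℕ.<? toℕ b
    ... | yes _   = refl
    ... | no a≮b  = contradiction x<y a≮b
    from (inj₂ (refl , refl)) with toℕ a ℕ.<? toℕ b
    ... | yes a<b = contradiction a<b (ℕₚ.<⇒≯ x<y)
    ... | no _    = refl

Steps-map : {N M : ℕ} (F : Perm N → Perm M) (G : Transp N → Transp M) →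
  (∀ t π → ValidT t → F (act t π) ≡ act (G t) (F π)) → (∀ t → ValidT t → ValidT (G t)) →
  ∀ {πs ts} → Steps πs ts → Steps (map F πs) (map G ts)
Steps-map F G F-act G-valid (single π) = single (F π)
Steps-map F G F-act G-valid (step π σ rest t ts v σ≡tπ s) =
  step (F π) (F σ) (map F rest) (G t) (map G ts) (G-valid t v) (trans (cong F σ≡tπ) (F-act t π v))
       (Steps-map F G F-act G-valid s)

Steps-++ : {N : ℕ} {πs σs : List (Perm N)} {ts us : List (Transp N)} {π σ : Perm N} {t : Transp N} →
  Steps πs ts → Steps σs us → Last πs π → First σs σ → ValidT t → σ ≡ act t π →
  Steps (πs ++ σs) (ts ++ t ∷ us)
Steps-++ {t = t} (single π) (single σ) refl refl v σ≡tπ = step π σ [] t [] v σ≡tπ (single σ)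
Steps-++ {t = t} (single π) s@(step σ _ _ _ _ _ _ _) refl refl v σ≡tπ = step π σ _ t _ v σ≡tπ s
Steps-++ {σs = σs} (step π π′ rest t′ ts v′ eq′ s) s′ last first v eq =
  step π π′ (rest ++ σs) t′ _ v′ eq′ (Steps-++ s s′ last first v eq)

Steps-length : {N : ℕ} {πs : List (Perm N)} {ts : List (Transp N)} → Steps πs ts → length πs ≡ suc (length ts)
Steps-length (single π)               = refl
Steps-length (step π σ rest t ts _ _ s) = cong suc (Steps-length s)

Steps-valid : {N : ℕ} {πs : List (Perm N)} {ts : List (Transp N)} → Steps πs ts → All ValidT ts
Steps-valid (single π)               = []
Steps-valid (step π σ rest t ts v _ s) = v ∷ Steps-valid s

module _ {A B : Set} where

  First-map : (f : A → B) {xs : List A} {a : A} → First xs a → First (map f xs) (f a)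
  First-map f {x ∷ xs} x≡a = cong f x≡a

  Last-map : (f : A → B) {xs : List A} {a : A} → Last xs a → Last (map f xs) (f a)
  Last-map f {x ∷ []}     x≡a  = cong f x≡a
  Last-map f {x ∷ y ∷ xs} last = Last-map f {y ∷ xs} last

First-++ : {A : Set} (xs ys : List A) {a : A} → First xs a → First (xs ++ ys) a
First-++ (x ∷ xs) ys x≡a = x≡a

Last-++ : {A : Set} (xs ys : List A) {a : A} → Last ys a → Last (xs ++ ys) a
Last-++ []            ys       last = last
Last-++ (x ∷ [])      (y ∷ ys) last = last
Last-++ (x ∷ x′ ∷ xs) ys       last = Last-++ (x′ ∷ xs) ys last

-- Cyclic relabelling of values

[m%d+n]%d≡[m+n]%d : ∀ m n d .{{_ : ℕ.NonZero d}} → (m % d + n) % d ≡ (m + n) % d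
[m%d+n]%d≡[m+n]%d m n d = begin
  (m % d + n) % d           ≡⟨ %-distribˡ-+ (m % d) n d ⟩
  (m % d % d + n % d) % d   ≡⟨ cong (λ x → (x + n % d) % d) (m%n%n≡m%n m d) ⟩
  (m % d + n % d) % d       ≡⟨ %-distribˡ-+ m n d ⟨
  (m + n) % d               ∎
  where open ≡-Reasoning

[m+n%d]%d≡[m+n]%d : ∀ m n d .{{_ : ℕ.NonZero d}} → (m + n % d) % d ≡ (m + n) % d
[m+n%d]%d≡[m+n]%d m n d = begin
  (m + n % d) % d ≡⟨ cong (_% d) (ℕₚ.+-comm m (n % d)) ⟩
  (n % d + m) % d ≡⟨ [m%d+n]%d≡[m+n]%d n m d ⟩
  (n + m) % d     ≡⟨ cong (_% d) (ℕₚ.+-comm n m) ⟩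
  (m + n) % d     ∎
  where open ≡-Reasoning

[m+d]%d≡m : ∀ {m} d .{{_ : ℕ.NonZero d}} → m < d → (m + d) % d ≡ m
[m+d]%d≡m {m} d m<d = trans ([m+n]%n≡m%n m d) (m<n⇒m%n≡m m<d)

[n+n]%[1+n]≡n∸1 : ∀ n → 1 ≤ n → (n + n) % suc n ≡ n ∸ 1
[n+n]%[1+n]≡n∸1 (suc n) _ =
  trans (cong (_% suc (suc n)) (sym (ℕₚ.+-suc n (suc n)))) ([m+d]%d≡m (suc (suc n)) (ℕₚ.m<n⇒m<1+n (ℕₚ.n<1+n n)))

module _ {n : ℕ} where

  shift : ℕ → Fin (suc n) → Fin (suc n)
  shift k x = (toℕ x + k) mod suc n

  -- offset x y is the unique k < n + 1 with shift k x ≡ y (offset-shift, shift-offset).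
  offset : Fin (suc n) → Fin (suc n) → ℕ
  offset x y = toℕ (shift (suc n ∸ toℕ x) y)

  toℕ-shift : ∀ k x → toℕ (shift k x) ≡ (toℕ x + k) % suc n
  toℕ-shift k x = Finₚ.toℕ-fromℕ< _

  shift-0 : ∀ x → shift 0 x ≡ x
  shift-0 x = Finₚ.toℕ-injective (trans (toℕ-shift 0 x)
    (trans (cong (_% suc n) (ℕₚ.+-identityʳ (toℕ x))) (m<n⇒m%n≡m (Finₚ.toℕ<n x))))

  shift-full : ∀ x → shift (suc n) x ≡ x
  shift-full x = Finₚ.toℕ-injective (trans (toℕ-shift (suc n) x) ([m+d]%d≡m (suc n) (Finₚ.toℕ<n x)))

  shift-+ : ∀ j k x → shift k (shift j x) ≡ shift (j + k) x
  shift-+ j k x = Finₚ.toℕ-injective (begin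
    toℕ (shift k (shift j x))         ≡⟨ toℕ-shift k (shift j x) ⟩
    (toℕ (shift j x) + k) % suc n     ≡⟨ cong (λ y → (y + k) % suc n) (toℕ-shift j x) ⟩
    ((toℕ x + j) % suc n + k) % suc n ≡⟨ [m%d+n]%d≡[m+n]%d (toℕ x + j) k (suc n) ⟩
    (toℕ x + j + k) % suc n           ≡⟨ cong (_% suc n) (ℕₚ.+-assoc (toℕ x) j k) ⟩
    (toℕ x + (j + k)) % suc n         ≡⟨ toℕ-shift (j + k) x ⟨
    toℕ (shift (j + k) x)             ∎)
    where open ≡-Reasoning

  shift-mod : ∀ k x → shift (k % suc n) x ≡ shift k x
  shift-mod k x = Finₚ.toℕ-injective (trans (toℕ-shift (k % suc n) x)
    (trans ([m+n%d]%d≡[m+n]%d (toℕ x) k (suc n)) (sym (toℕ-shift k x))))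

  shift-inverse : ∀ {k} → k ≤ suc n → ∀ x → shift (suc n ∸ k) (shift k x) ≡ x
  shift-inverse {k} k≤1+n x = begin
    shift (suc n ∸ k) (shift k x) ≡⟨ shift-+ k (suc n ∸ k) x ⟩
    shift (k + (suc n ∸ k)) x     ≡⟨ cong (λ j → shift j x) (ℕₚ.m+[n∸m]≡n k≤1+n) ⟩
    shift (suc n) x               ≡⟨ shift-full x ⟩
    x                             ∎
    where open ≡-Reasoning

  shift-injective : ∀ k {x y} → shift k x ≡ shift k y → x ≡ y
  shift-injective k {x} {y} eq = begin
    x                                             ≡⟨ shift-inverse r≤1+n x ⟨
    shift (suc n ∸ r) (shift r x)                 ≡⟨ cong (shift (suc n ∸ r)) (trans (shift-mod k x) (trans eq (sym (shift-mod k y)))) ⟩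
    shift (suc n ∸ r) (shift r y)                 ≡⟨ shift-inverse r≤1+n y ⟩
    y                                             ∎
    where
    open ≡-Reasoning
    r = k % suc n
    r≤1+n : r ≤ suc n
    r≤1+n = m%n≤n k (suc n)

  private
    x+[k+[m∸x]]≡k+m : ∀ (x : Fin (suc n)) k → toℕ x + (k + (suc n ∸ toℕ x)) ≡ k + suc n
    x+[k+[m∸x]]≡k+m x k = trans (x+[y+z]≡y+[x+z] (toℕ x) k _) (cong (k +_) (ℕₚ.m+[n∸m]≡n (ℕₚ.<⇒≤ (Finₚ.toℕ<n x))))

  offset-shift : ∀ {k} → k < suc n → ∀ x → offset x (shift k x) ≡ k
  offset-shift {k} k<1+n x = begin
    toℕ (shift (suc n ∸ toℕ x) (shift k x))  ≡⟨ cong toℕ (shift-+ k (suc n ∸ toℕ x) x) ⟩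
    toℕ (shift (k + (suc n ∸ toℕ x)) x)      ≡⟨ toℕ-shift _ x ⟩
    (toℕ x + (k + (suc n ∸ toℕ x))) % suc n  ≡⟨ cong (_% suc n) (x+[k+[m∸x]]≡k+m x k) ⟩
    (k + suc n) % suc n                      ≡⟨ [m+d]%d≡m (suc n) k<1+n ⟩
    k                                        ∎
    where open ≡-Reasoning

  shift-offset : ∀ x y → shift (offset x y) x ≡ y
  shift-offset x y = Finₚ.toℕ-injective (begin
    toℕ (shift (offset x y) x)                          ≡⟨ toℕ-shift (offset x y) x ⟩
    (toℕ x + offset x y) % suc n                        ≡⟨ cong (λ z → (toℕ x + z) % suc n) (toℕ-shift _ y) ⟩
    (toℕ x + (toℕ y + (suc n ∸ toℕ x)) % suc n) % suc n ≡⟨ [m+n%d]%d≡[m+n]%d (toℕ x) _ (suc n) ⟩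
    (toℕ x + (toℕ y + (suc n ∸ toℕ x))) % suc n         ≡⟨ cong (_% suc n) (x+[k+[m∸x]]≡k+m x (toℕ y)) ⟩
    (toℕ y + suc n) % suc n                             ≡⟨ [m+d]%d≡m (suc n) (Finₚ.toℕ<n y) ⟩
    toℕ y                                               ∎)
    where open ≡-Reasoning

  shift-gap : ∀ {x y} → toℕ x ≤ toℕ y → shift (toℕ y ∸ toℕ x) x ≡ y
  shift-gap {x} {y} x≤y = Finₚ.toℕ-injective (begin
    toℕ (shift (toℕ y ∸ toℕ x) x)       ≡⟨ toℕ-shift _ x ⟩
    (toℕ x + (toℕ y ∸ toℕ x)) % suc n   ≡⟨ cong (_% suc n) (ℕₚ.m+[n∸m]≡n x≤y) ⟩
    toℕ y % suc n                       ≡⟨ m<n⇒m%n≡m (Finₚ.toℕ<n y) ⟩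
    toℕ y                               ∎)
    where open ≡-Reasoning

  offset-gap : ∀ {x y} → toℕ x < toℕ y → offset x y ≡ toℕ y ∸ toℕ x
  offset-gap {x} {y} x<y = begin
    offset x y                                   ≡⟨ cong (offset x) (shift-gap (ℕₚ.<⇒≤ x<y)) ⟨
    offset x (shift (toℕ y ∸ toℕ x) x)           ≡⟨ offset-shift (gap<N (x , y)) x ⟩
    toℕ y ∸ toℕ x                                ∎
    where open ≡-Reasoning

  offset-cogap : ∀ {x y} → toℕ x < toℕ y → offset y x ≡ suc n ∸ (toℕ y ∸ toℕ x)
  offset-cogap {x} {y} x<y = begin
    offset y x                                   ≡⟨ cong (offset y) (shift-inverse e≤1+n x) ⟨
    offset y (shift (suc n ∸ e) (shift e x))     ≡⟨ cong (λ z → offset y (shift (suc n ∸ e) z)) (shift-gap (ℕₚ.<⇒≤ x<y)) ⟩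
    offset y (shift (suc n ∸ e) y)               ≡⟨ offset-shift (ℕₚ.∸-monoʳ-< (ℕₚ.m<n⇒0<n∸m x<y) e≤1+n) y ⟩
    suc n ∸ e                                    ∎
    where
    open ≡-Reasoning
    e = toℕ y ∸ toℕ x
    e≤1+n : e ≤ suc n
    e≤1+n = ℕₚ.<⇒≤ (gap<N (x , y))

module _ {n : ℕ} where

  shiftT : ℕ → Transp (suc n) → Transp (suc n)
  shiftT k (i , j) = transp (shift k i) (shift k j)

  relabel : ℕ → Perm (suc n) → Perm (suc n)
  relabel k = Vec.map (shift k)

  shiftT-valid : ∀ k {t} → ValidT t → ValidT (shiftT k t)
  shiftT-valid k {i , j} i<j = transp-valid (ℕₚ.<⇒≢ i<j ∘ cong toℕ ∘ shift-injective k)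

  relabel-act : ∀ k t π → relabel k (act t π) ≡ act (shiftT k t) (relabel k π)
  relabel-act k (i , j) π = begin
    Vec.map (shift k) (Vec.map (swapVal i j) π)           ≡⟨ Vecₚ.map-∘ (shift k) (swapVal i j) π ⟨
    Vec.map (shift k ∘ swapVal i j) π                     ≡⟨ Vecₚ.map-cong (swapVal-natural (shift k) (shift-injective k) i j) π ⟩
    Vec.map (swapVal (shift k i) (shift k j) ∘ shift k) π ≡⟨ Vecₚ.map-∘ (swapVal (shift k i) (shift k j)) (shift k) π ⟩
    Vec.map (swapVal (shift k i) (shift k j)) (relabel k π) ≡⟨ act-transp (shift k i) (shift k j) (relabel k π) ⟨
    act (shiftT k (i , j)) (relabel k π)                  ∎
    where open ≡-Reasoning

  relabel-+ : ∀ j k π → relabel k (relabel j π) ≡ relabel (j + k) π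
  relabel-+ j k π = trans (sym (Vecₚ.map-∘ (shift k) (shift j) π)) (Vecₚ.map-cong (shift-+ j k) π)

  relabel-full : ∀ π → relabel (suc n) π ≡ π
  relabel-full π = trans (Vecₚ.map-cong shift-full π) (Vecₚ.map-id π)

  relabel-0 : ∀ π → relabel 0 π ≡ π
  relabel-0 π = trans (Vecₚ.map-cong shift-0 π) (Vecₚ.map-id π)

  relabel-injective : ∀ k {π σ} → relabel k π ≡ relabel k σ → π ≡ σ
  relabel-injective k = map-injective (shift-injective k)

  relabel-IsPerm : ∀ k π → IsPerm π → IsPerm (relabel k π)
  relabel-IsPerm k π perm i j eq =
    perm i j (shift-injective k (trans (sym (Vecₚ.lookup-map i (shift k) π)) (trans eq (Vecₚ.lookup-map j (shift k) π))))

  private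
    shift-along-gap : ∀ k {i j : Fin (suc n)} → toℕ i ≤ toℕ j → shift k j ≡ shift (toℕ j ∸ toℕ i) (shift k i)
    shift-along-gap k {i} {j} i≤j = begin
      shift k j                 ≡⟨ cong (shift k) (shift-gap i≤j) ⟨
      shift k (shift d i)       ≡⟨ shift-+ d k i ⟩
      shift (d + k) i           ≡⟨ cong (λ e → shift e i) (ℕₚ.+-comm d k) ⟩
      shift (k + d) i           ≡⟨ shift-+ k d i ⟨
      shift d (shift k i)       ∎
      where
      open ≡-Reasoning
      d = toℕ j ∸ toℕ i

    images⇔offsets : ∀ {k} → k < suc n → ∀ {i j : Fin (suc n)} → toℕ i < toℕ j → ∀ u v →
      (shift k i ≡ u × shift k j ≡ v) ⇔ (k ≡ offset i u × gap (i , j) ≡ offset u v)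
    images⇔offsets {k} k<1+n {i} {j} i<j u v = mk⇔ to from
      where
      j≡ : shift k j ≡ shift (gap (i , j)) (shift k i)
      j≡ = shift-along-gap k (ℕₚ.<⇒≤ i<j)
      to : shift k i ≡ u × shift k j ≡ v → k ≡ offset i u × gap (i , j) ≡ offset u v
      to (refl , refl) = sym (offset-shift k<1+n i) , (begin
        gap (i , j)                                          ≡⟨ offset-shift (gap<N (i , j)) (shift k i) ⟨
        offset (shift k i) (shift (gap (i , j)) (shift k i)) ≡⟨ cong (offset (shift k i)) j≡ ⟨
        offset (shift k i) (shift k j)                       ∎)
        where open ≡-Reasoning
      from : k ≡ offset i u × gap (i , j) ≡ offset u v → shift k i ≡ u × shift k j ≡ v
      from (refl , d≡) = shift-offset i u , (begin
        shift k j                       ≡⟨ j≡ ⟩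
        shift (gap (i , j)) (shift k i) ≡⟨ cong₂ shift d≡ (shift-offset i u) ⟩
        shift (offset u v) u            ≡⟨ shift-offset u v ⟩
        v                               ∎)
        where open ≡-Reasoning

  𝟙-shiftT : ∀ {k} → k < suc n → ∀ {i j x y : Fin (suc n)} → toℕ i < toℕ j → toℕ x < toℕ y →
    𝟙 (shiftT k (i , j) ≟ₜ (x , y)) ≡
      𝟙 (k ℕ.≟ offset i x) * 𝟙 (gap (i , j) ℕ.≟ offset x y) + 𝟙 (k ℕ.≟ offset i y) * 𝟙 (gap (i , j) ℕ.≟ offset y x)
  𝟙-shiftT {k} k<1+n {i} {j} {x} {y} i<j x<y = begin
    𝟙 (shiftT k (i , j) ≟ₜ (x , y))
      ≡⟨ 𝟙-cong (⇔-trans (transp-≡ x<y) (images⇔offsets k<1+n i<j x y ⊎-⇔ images⇔offsets k<1+n i<j y x)) _ (A ⊎-dec B) ⟩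
    𝟙 (A ⊎-dec B) ≡⟨ 𝟙-⊎ disjoint A B ⟩
    𝟙 A + 𝟙 B     ≡⟨ cong₂ _+_ (𝟙-× (k ℕ.≟ offset i x) (gap (i , j) ℕ.≟ offset x y))
                               (𝟙-× (k ℕ.≟ offset i y) (gap (i , j) ℕ.≟ offset y x)) ⟩
    𝟙 (k ℕ.≟ offset i x) * 𝟙 (gap (i , j) ℕ.≟ offset x y) + 𝟙 (k ℕ.≟ offset i y) * 𝟙 (gap (i , j) ℕ.≟ offset y x) ∎
    where
    open ≡-Reasoning
    A = k ℕ.≟ offset i x ×-dec gap (i , j) ℕ.≟ offset x y
    B = k ℕ.≟ offset i y ×-dec gap (i , j) ℕ.≟ offset y x
    disjoint : ¬ ((k ≡ offset i x × gap (i , j) ≡ offset x y) × (k ≡ offset i y × gap (i , j) ≡ offset y x))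
    disjoint ((kx , _) , (ky , _)) = ℕₚ.<⇒≢ x<y (cong toℕ (begin
      x                          ≡⟨ shift-offset i x ⟨
      shift (offset i x) i       ≡⟨ cong (λ e → shift e i) (trans (sym kx) ky) ⟩
      shift (offset i y) i       ≡⟨ shift-offset i y ⟩
      y                          ∎))

  ∑𝟙-shiftT : ∀ {i j x y : Fin (suc n)} → toℕ i < toℕ j → toℕ x < toℕ y →
    ∑[ k < suc n ] 𝟙 (shiftT k (i , j) ≟ₜ (x , y)) ≡ 𝟙 (gap (i , j) ℕ.≟ gap (x , y)) + 𝟙 (gap (i , j) ℕ.≟ suc n ∸ gap (x , y))
  ∑𝟙-shiftT {i} {j} {x} {y} i<j x<y = begin
    ∑[ k < suc n ] 𝟙 (shiftT k (i , j) ≟ₜ (x , y))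
      ≡⟨ ∑<-cong (suc n) (λ k k<1+n → 𝟙-shiftT k<1+n i<j x<y) ⟩
    ∑[ k < suc n ] (𝟙 (k ℕ.≟ offset i x) * P + 𝟙 (k ℕ.≟ offset i y) * Q)
      ≡⟨ ∑<-+ (suc n) (λ k → 𝟙 (k ℕ.≟ offset i x) * P) (λ k → 𝟙 (k ℕ.≟ offset i y) * Q) ⟩
    ∑[ k < suc n ] (𝟙 (k ℕ.≟ offset i x) * P) + ∑[ k < suc n ] (𝟙 (k ℕ.≟ offset i y) * Q)
      ≡⟨ cong₂ _+_ (∑<-δ* (suc n) P (Finₚ.toℕ<n _)) (∑<-δ* (suc n) Q (Finₚ.toℕ<n _)) ⟩
    P + Q
      ≡⟨ cong₂ (λ a b → 𝟙 (gap (i , j) ℕ.≟ a) + 𝟙 (gap (i , j) ℕ.≟ b)) (offset-gap x<y) (offset-cogap x<y) ⟩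
    𝟙 (gap (i , j) ℕ.≟ gap (x , y)) + 𝟙 (gap (i , j) ℕ.≟ suc n ∸ gap (x , y)) ∎
    where
    open ≡-Reasoning
    P = 𝟙 (gap (i , j) ℕ.≟ offset x y)
    Q = 𝟙 (gap (i , j) ℕ.≟ offset y x)

-- Lifting S_n into S_(n+1)

module _ {n : ℕ} where

  lift : Perm n → Perm (suc n)
  lift π = Vec.map inject₁ π ∷ʳ fromℕ n

  liftT : Transp n → Transp (suc n)
  liftT (i , j) = inject₁ i , inject₁ j

  lookup-lift-last : ∀ π → lookup (lift π) (fromℕ n) ≡ fromℕ n
  lookup-lift-last π = lookup-∷ʳ-last (Vec.map inject₁ π) (fromℕ n)

  lookup-lift-inject₁ : ∀ π p → lookup (lift π) (inject₁ p) ≡ inject₁ (lookup π p)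
  lookup-lift-inject₁ π p = trans (lookup-∷ʳ-inject₁ (Vec.map inject₁ π) (fromℕ n) p) (Vecₚ.lookup-map p inject₁ π)

  liftT-valid : ∀ {t} → ValidT t → ValidT (liftT t)
  liftT-valid {i , j} i<j = subst₂ _<_ (sym (Finₚ.toℕ-inject₁ i)) (sym (Finₚ.toℕ-inject₁ j)) i<j

  gap-liftT : ∀ t → gap (liftT t) ≡ gap t
  gap-liftT (i , j) = cong₂ _∸_ (Finₚ.toℕ-inject₁ j) (Finₚ.toℕ-inject₁ i)

  lift-act : ∀ t π → lift (act t π) ≡ act (liftT t) (lift π)
  lift-act (i , j) π = sym (begin
    Vec.map (swapVal i′ j′) (Vec.map inject₁ π ∷ʳ fromℕ n)
      ≡⟨ Vecₚ.map-∷ʳ (swapVal i′ j′) (fromℕ n) (Vec.map inject₁ π) ⟩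
    Vec.map (swapVal i′ j′) (Vec.map inject₁ π) ∷ʳ swapVal i′ j′ (fromℕ n)
      ≡⟨ cong₂ _∷ʳ_ inner (swapVal-other i′ j′ (fromℕ n) Finₚ.fromℕ≢inject₁ Finₚ.fromℕ≢inject₁) ⟩
    Vec.map inject₁ (Vec.map (swapVal i j) π) ∷ʳ fromℕ n ∎)
    where
    open ≡-Reasoning
    i′ = inject₁ i
    j′ = inject₁ j
    inner : Vec.map (swapVal i′ j′) (Vec.map inject₁ π) ≡ Vec.map inject₁ (Vec.map (swapVal i j) π)
    inner = trans (sym (Vecₚ.map-∘ (swapVal i′ j′) inject₁ π))
      (trans (Vecₚ.map-cong (λ x → sym (swapVal-natural inject₁ Finₚ.inject₁-injective i j x)) π)
             (Vecₚ.map-∘ inject₁ (swapVal i j) π))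

  lift-injective : ∀ {π σ} → lift π ≡ lift σ → π ≡ σ
  lift-injective {π} {σ} eq = map-injective Finₚ.inject₁-injective (Vecₚ.∷ʳ-injectiveˡ _ _ eq)

  lookup-lift-inject₁≢top : ∀ π p → lookup (lift π) (inject₁ p) ≢ fromℕ n
  lookup-lift-inject₁≢top π p eq = Finₚ.fromℕ≢inject₁ (trans (sym eq) (lookup-lift-inject₁ π p))

  lift-IsPerm : ∀ π → IsPerm π → IsPerm (lift π)
  lift-IsPerm π perm i j eq with view i | view j
  ... | ‵fromℕ     | ‵fromℕ     = refl
  ... | ‵fromℕ     | ‵inject₁ q = contradiction (trans (sym eq) (lookup-lift-last π)) (lookup-lift-inject₁≢top π q)
  ... | ‵inject₁ p | ‵fromℕ     = contradiction (trans eq (lookup-lift-last π)) (lookup-lift-inject₁≢top π p)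
  ... | ‵inject₁ p | ‵inject₁ q =
    cong inject₁ (perm p q (Finₚ.inject₁-injective (trans (sym (lookup-lift-inject₁ π p)) (trans eq (lookup-lift-inject₁ π q)))))

  lift-idPerm : lift (idPerm n) ≡ idPerm (suc n)
  lift-idPerm = lookup-extensionality λ i → trans (at i) (sym (Vecₚ.lookup∘tabulate id i))
    where
    at : ∀ i → lookup (lift (idPerm n)) i ≡ i
    at i with view i
    ... | ‵fromℕ     = lookup-lift-last (idPerm n)
    ... | ‵inject₁ p = trans (lookup-lift-inject₁ (idPerm n) p) (cong inject₁ (Vecₚ.lookup∘tabulate id p))

  lift-surjective : ∀ {π} → IsPerm π → lookup π (fromℕ n) ≡ fromℕ n → Σ (Perm n) λ σ → IsPerm σ × lift σ ≡ π
  lift-surjective {π} perm fixes-top = σ , σ-perm , lookup-extensionality at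
    where
    not-top : ∀ p → n ≢ toℕ (lookup π (inject₁ p))
    not-top p n≡ = Finₚ.fromℕ≢inject₁ (sym (perm (inject₁ p) (fromℕ n)
      (trans (Finₚ.toℕ-injective (trans (sym n≡) (sym (Finₚ.toℕ-fromℕ n)))) (sym fixes-top))))
    σ : Perm n
    σ = tabulate λ p → lower₁ (lookup π (inject₁ p)) (not-top p)
    lookup-σ : ∀ p → inject₁ (lookup σ p) ≡ lookup π (inject₁ p)
    lookup-σ p = trans (cong inject₁ (Vecₚ.lookup∘tabulate _ p)) (Finₚ.inject₁-lower₁ _ (not-top p))
    σ-perm : IsPerm σ
    σ-perm p q eq = Finₚ.inject₁-injective (perm (inject₁ p) (inject₁ q) (trans (sym (lookup-σ p)) (trans (cong inject₁ eq) (lookup-σ q))))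
    at : ∀ i → lookup (lift σ) i ≡ lookup π i
    at i with view i
    ... | ‵fromℕ     = trans (lookup-lift-last σ) (sym fixes-top)
    ... | ‵inject₁ p = trans (lookup-lift-inject₁ σ p) (lookup-σ p)

-- The extended Gray code

succMod-< : {N : ℕ} (i : Fin N) → suc (toℕ i) < N → toℕ (succMod i) ≡ suc (toℕ i)
succMod-< {suc zero}    Fin.zero    (s≤s ())
succMod-< {suc (suc N)} Fin.zero    _ = refl
succMod-< {suc (suc N)} (Fin.suc i) 2+i<2+N with succMod {suc N} i | succMod-< i (ℕ.s≤s⁻¹ 2+i<2+N)
... | Fin.suc k | eq = cong suc eq

succMod-top : {N : ℕ} (i : Fin N) → suc (toℕ i) ≡ N → toℕ (succMod i) ≡ 0
succMod-top {suc zero}    Fin.zero    _ = refl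
succMod-top {suc (suc N)} (Fin.suc i) 2+i≡2+N with succMod {suc N} i | succMod-top i (ℕₚ.suc-injective 2+i≡2+N)
... | Fin.zero | _ = refl

module _ {n : ℕ} where

  bridge₀ : Transp (suc n)
  bridge₀ = Fin.zero , fromℕ n

  shift-1-top : shift 1 (fromℕ n) ≡ Fin.zero
  shift-1-top = Finₚ.toℕ-injective (begin
    toℕ (shift 1 (fromℕ n))       ≡⟨ toℕ-shift 1 (fromℕ n) ⟩
    (toℕ (fromℕ n) + 1) % suc n   ≡⟨ cong (λ x → (x + 1) % suc n) (Finₚ.toℕ-fromℕ n) ⟩
    (n + 1) % suc n               ≡⟨ cong (_% suc n) (ℕₚ.+-comm n 1) ⟩
    suc n % suc n                 ≡⟨ n%n≡0 (suc n) ⟩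
    0                             ∎)
    where open ≡-Reasoning

  shift-1-inject₁ : ∀ p → shift 1 (inject₁ p) ≡ Fin.suc p
  shift-1-inject₁ p = Finₚ.toℕ-injective (begin
    toℕ (shift 1 (inject₁ p))      ≡⟨ toℕ-shift 1 (inject₁ p) ⟩
    (toℕ (inject₁ p) + 1) % suc n  ≡⟨ cong (λ x → (x + 1) % suc n) (Finₚ.toℕ-inject₁ p) ⟩
    (toℕ p + 1) % suc n            ≡⟨ cong (_% suc n) (ℕₚ.+-comm (toℕ p) 1) ⟩
    suc (toℕ p) % suc n            ≡⟨ m<n⇒m%n≡m (s≤s (Finₚ.toℕ<n p)) ⟩
    suc (toℕ p)                    ∎)
    where open ≡-Reasoning

  swapVal-succMod : ∀ p → swapVal Fin.zero (fromℕ n) (inject₁ (succMod p)) ≡ Fin.suc p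
  swapVal-succMod p with suc (toℕ p) ℕ.<? n
  ... | yes 1+p<n = trans (swapVal-other _ _ _ ≢zero ≢top) (Finₚ.toℕ-injective toℕ-succMod)
    where
    toℕ-succMod : toℕ (inject₁ (succMod p)) ≡ suc (toℕ p)
    toℕ-succMod = trans (Finₚ.toℕ-inject₁ (succMod p)) (succMod-< p 1+p<n)
    ≢zero : inject₁ (succMod p) ≢ Fin.zero
    ≢zero eq = ℕₚ.0≢1+n (trans (sym (cong toℕ eq)) toℕ-succMod)
    ≢top : inject₁ (succMod p) ≢ fromℕ n
    ≢top eq = ℕₚ.<⇒≢ 1+p<n (trans (sym toℕ-succMod) (trans (cong toℕ eq) (Finₚ.toℕ-fromℕ n)))
  ... | no 1+p≮n = trans (cong (swapVal Fin.zero (fromℕ n)) is-zero) (trans (swapVal-left Fin.zero (fromℕ n))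
                     (Finₚ.toℕ-injective (trans (Finₚ.toℕ-fromℕ n) (sym 1+p≡n))))
    where
    1+p≡n : suc (toℕ p) ≡ n
    1+p≡n = ℕₚ.≤-antisym (Finₚ.toℕ<n p) (ℕₚ.≮⇒≥ 1+p≮n)
    is-zero : inject₁ (succMod p) ≡ Fin.zero
    is-zero = Finₚ.toℕ-injective (trans (Finₚ.toℕ-inject₁ (succMod p)) (succMod-top p 1+p≡n))

  -- Shifting 1 2 ⋯ n (n+1) by one gives 2 3 ⋯ (n+1) 1, which is 2 3 ⋯ n 1 (n+1) with 1 and n + 1 exchanged.
  relabel-lift-idPerm : relabel 1 (lift (idPerm n)) ≡ act bridge₀ (lift (rotPerm n))
  relabel-lift-idPerm = lookup-extensionality λ i → begin
    lookup (relabel 1 (lift (idPerm n))) i                  ≡⟨ Vecₚ.lookup-map i (shift 1) (lift (idPerm n)) ⟩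
    shift 1 (lookup (lift (idPerm n)) i)                    ≡⟨ at i ⟩
    swapVal Fin.zero (fromℕ n) (lookup (lift (rotPerm n)) i) ≡⟨ Vecₚ.lookup-map i (swapVal Fin.zero (fromℕ n)) (lift (rotPerm n)) ⟨
    lookup (act bridge₀ (lift (rotPerm n))) i               ∎
    where
    open ≡-Reasoning
    at : ∀ i → shift 1 (lookup (lift (idPerm n)) i) ≡ swapVal Fin.zero (fromℕ n) (lookup (lift (rotPerm n)) i)
    at i with view i
    ... | ‵fromℕ = begin
      shift 1 (lookup (lift (idPerm n)) (fromℕ n))  ≡⟨ cong (shift 1) (lookup-lift-last (idPerm n)) ⟩
      shift 1 (fromℕ n)                            ≡⟨ shift-1-top ⟩
      Fin.zero                                     ≡⟨ swapVal-right Fin.zero (fromℕ n) ⟨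
      swapVal Fin.zero (fromℕ n) (fromℕ n)         ≡⟨ cong (swapVal Fin.zero (fromℕ n)) (lookup-lift-last (rotPerm n)) ⟨
      swapVal Fin.zero (fromℕ n) (lookup (lift (rotPerm n)) (fromℕ n)) ∎
    ... | ‵inject₁ p = begin
      shift 1 (lookup (lift (idPerm n)) (inject₁ p))  ≡⟨ cong (shift 1) (lookup-lift-inject₁ (idPerm n) p) ⟩
      shift 1 (inject₁ (lookup (idPerm n) p))         ≡⟨ cong (shift 1 ∘ inject₁) (Vecₚ.lookup∘tabulate id p) ⟩
      shift 1 (inject₁ p)                             ≡⟨ shift-1-inject₁ p ⟩
      Fin.suc p                                       ≡⟨ swapVal-succMod p ⟨
      swapVal Fin.zero (fromℕ n) (inject₁ (succMod p)) ≡⟨ cong (swapVal Fin.zero (fromℕ n) ∘ inject₁) (Vecₚ.lookup∘tabulate succMod p) ⟨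
      swapVal Fin.zero (fromℕ n) (inject₁ (lookup (rotPerm n) p)) ≡⟨ cong (swapVal Fin.zero (fromℕ n)) (lookup-lift-inject₁ (rotPerm n) p) ⟨
      swapVal Fin.zero (fromℕ n) (lookup (lift (rotPerm n)) (inject₁ p)) ∎

module Extension (n : ℕ) where

  copy : ℕ → List (Perm n) → List (Perm (suc n))
  copy k = map (relabel k ∘ lift)

  copyT : ℕ → List (Transp n) → List (Transp (suc n))
  copyT k = map (shiftT k ∘ liftT)

  bridge : ℕ → Transp (suc n)
  bridge k = shiftT k bridge₀

  extension : ℕ → List (Perm n) → List (Perm (suc n))
  extension zero    πs = copy 0 πs
  extension (suc c) πs = extension c πs ++ copy (suc c) πs

  extensionT : ℕ → List (Transp n) → List (Transp (suc n))
  extensionT zero    ts = copyT 0 ts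
  extensionT (suc c) ts = extensionT c ts ++ bridge c ∷ copyT (suc c) ts

  copy-Steps : ∀ k {πs ts} → Steps πs ts → Steps (copy k πs) (copyT k ts)
  copy-Steps k = Steps-map (relabel k ∘ lift) (shiftT k ∘ liftT)
    (λ t π _ → trans (cong (relabel k) (lift-act t π)) (relabel-act k (liftT t) (lift π)))
    (λ t v → shiftT-valid k (liftT-valid v))

  bridge₀-valid : 1 ≤ n → ValidT (bridge₀ {n})
  bridge₀-valid 1≤n = subst (0 <_) (sym (Finₚ.toℕ-fromℕ n)) 1≤n

  bridge-valid : 1 ≤ n → ∀ k → ValidT (bridge k)
  bridge-valid 1≤n k = shiftT-valid k (bridge₀-valid 1≤n)

  bridge-step : ∀ c → relabel (suc c) (lift (idPerm n)) ≡ act (bridge c) (relabel c (lift (rotPerm n)))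
  bridge-step c = begin
    relabel (suc c) (lift (idPerm n))           ≡⟨ relabel-+ 1 c (lift (idPerm n)) ⟨
    relabel c (relabel 1 (lift (idPerm n)))     ≡⟨ cong (relabel c) relabel-lift-idPerm ⟩
    relabel c (act bridge₀ (lift (rotPerm n)))  ≡⟨ relabel-act c bridge₀ (lift (rotPerm n)) ⟩
    act (bridge c) (relabel c (lift (rotPerm n))) ∎
    where open ≡-Reasoning

  extension-First : ∀ {πs a} c → First πs a → First (extension c πs) (relabel 0 (lift a))
  extension-First {πs} zero    first = First-map (relabel 0 ∘ lift) {πs} first
  extension-First {πs} (suc c) first = First-++ (extension c πs) (copy (suc c) πs) (extension-First c first)

  extension-Last : ∀ {πs b} c → Last πs b → Last (extension c πs) (relabel c (lift b))
  extension-Last {πs} zero    last = Last-map (relabel 0 ∘ lift) {πs} last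
  extension-Last {πs} (suc c) last = Last-++ (extension c πs) (copy (suc c) πs) (Last-map (relabel (suc c) ∘ lift) {πs} last)

  extension-Steps : 1 ≤ n → ∀ {πs ts} → Steps πs ts → First πs (idPerm n) → Last πs (rotPerm n) →
                    ∀ c → Steps (extension c πs) (extensionT c ts)
  extension-Steps 1≤n steps first last zero    = copy-Steps 0 steps
  extension-Steps 1≤n {πs} steps first last (suc c) =
    Steps-++ (extension-Steps 1≤n steps first last c) (copy-Steps (suc c) steps) (extension-Last c last)
             (First-map (relabel (suc c) ∘ lift) {πs} first) (bridge-valid 1≤n c) (bridge-step c)

  first-copy : relabel 0 (lift (idPerm n)) ≡ idPerm (suc n)
  first-copy = trans (relabel-0 (lift (idPerm n))) lift-idPerm

  bridge-last : 1 ≤ n → bridge n ≡ lastTwo n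
  bridge-last 1≤n = Equivalence.from (transp-≡ n∸1<n) (inj₂ (top , below-top))
    where
    n∸1<n : toℕ (fromℕ< (n∸1<1+n n)) < toℕ (fromℕ n)
    n∸1<n = subst₂ _<_ (sym (Finₚ.toℕ-fromℕ< (n∸1<1+n n))) (sym (Finₚ.toℕ-fromℕ n)) (ℕₚ.∸-monoʳ-< {n} {1} {0} (s≤s z≤n) 1≤n)
    top : shift n Fin.zero ≡ fromℕ n
    top = Finₚ.toℕ-injective (trans (toℕ-shift n Fin.zero) (trans (m<n⇒m%n≡m (ℕₚ.n<1+n n)) (sym (Finₚ.toℕ-fromℕ n))))
    below-top : shift n (fromℕ n) ≡ fromℕ< (n∸1<1+n n)
    below-top = Finₚ.toℕ-injective (begin
      toℕ (shift n (fromℕ n))      ≡⟨ toℕ-shift n (fromℕ n) ⟩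
      (toℕ (fromℕ n) + n) % suc n  ≡⟨ cong (λ x → (x + n) % suc n) (Finₚ.toℕ-fromℕ n) ⟩
      (n + n) % suc n              ≡⟨ [n+n]%[1+n]≡n∸1 n 1≤n ⟩
      n ∸ 1                        ≡⟨ Finₚ.toℕ-fromℕ< (n∸1<1+n n) ⟨
      toℕ (fromℕ< (n∸1<1+n n))     ∎)
      where open ≡-Reasoning

  -- Instead of computing it: the bridge out of the last copy leads to the relabelling by n + 1, i.e. back to 1 2 ⋯ (n+1).
  last-copy : 1 ≤ n → relabel n (lift (rotPerm n)) ≡ swappedId n
  last-copy 1≤n = begin
    relabel n (lift (rotPerm n))                                   ≡⟨ act-involutive (bridge n) _ ⟨
    act (bridge n) (act (bridge n) (relabel n (lift (rotPerm n)))) ≡⟨ cong (act (bridge n)) (bridge-step n) ⟨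
    act (bridge n) (relabel (suc n) (lift (idPerm n)))             ≡⟨ cong₂ act (bridge-last 1≤n) (trans (relabel-full _) lift-idPerm) ⟩
    swappedId n                                                    ∎
    where open ≡-Reasoning

  lookup-top-copy : ∀ {πs} k {π} → π ∈ copy k πs → lookup π (fromℕ n) ≡ shift k (fromℕ n)
  lookup-top-copy k mem with ∈-map⁻ (relabel k ∘ lift) mem
  ... | σ , _ , refl = trans (Vecₚ.lookup-map (fromℕ n) (shift k) (lift σ)) (cong (shift k) (lookup-lift-last σ))

  ∈-extension⁻ : ∀ {πs} c {π} → π ∈ extension c πs → Σ ℕ λ k → k ≤ c × π ∈ copy k πs
  ∈-extension⁻ zero    mem = 0 , z≤n , mem
  ∈-extension⁻ {πs} (suc c) mem with ∈-++⁻ (extension c πs) mem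
  ... | inj₁ mem′ = let k , k≤c , mem″ = ∈-extension⁻ c mem′ in k , ℕₚ.m≤n⇒m≤1+n k≤c , mem″
  ... | inj₂ mem′ = suc c , ℕₚ.≤-refl , mem′

  ∈-extension⁺ : ∀ {πs} c {k π} → k ≤ c → π ∈ copy k πs → π ∈ extension c πs
  ∈-extension⁺ zero    z≤n mem = mem
  ∈-extension⁺ {πs} (suc c) {k} k≤1+c mem with k ℕ.≟ suc c
  ... | yes refl = ∈-++⁺ʳ (extension c πs) mem
  ... | no k≢1+c = ∈-++⁺ˡ (∈-extension⁺ c (ℕ.s≤s⁻¹ (ℕₚ.≤∧≢⇒< k≤1+c k≢1+c)) mem)

  length-extension : ∀ c πs → length (extension c πs) ≡ suc c * length πs
  length-extension zero    πs = trans (Listₚ.length-map _ πs) (sym (ℕₚ.+-identityʳ _))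
  length-extension (suc c) πs = begin
    length (extension c πs ++ copy (suc c) πs)          ≡⟨ Listₚ.length-++ (extension c πs) ⟩
    length (extension c πs) + length (copy (suc c) πs)  ≡⟨ cong₂ _+_ (length-extension c πs) (Listₚ.length-map _ πs) ⟩
    suc c * length πs + length πs                       ≡⟨ ℕₚ.+-comm (suc c * length πs) (length πs) ⟩
    suc (suc c) * length πs                             ∎
    where open ≡-Reasoning

  copy-Unique : ∀ k {πs} → Unique πs → Unique (copy k πs)
  copy-Unique k = Uniqueₚ.map⁺ (lift-injective ∘ relabel-injective k)

  extension-Unique : ∀ {πs} c → c ≤ n → Unique πs → Unique (extension c πs)
  extension-Unique zero    _     unique = copy-Unique 0 unique
  extension-Unique {πs} (suc c) 1+c≤n unique =
    Uniqueₚ.++⁺ (extension-Unique c (ℕₚ.<⇒≤ 1+c≤n) unique) (copy-Unique (suc c) unique) disjoint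
    where
    -- Copies are told apart by the entry in the last position.
    disjoint : ∀ {π} → ¬ (π ∈ extension c πs × π ∈ copy (suc c) πs)
    disjoint {π} (mem , mem′) with ∈-extension⁻ c mem
    ... | k , k≤c , mem″ = ℕₚ.<⇒≢ (s≤s k≤c) (begin
      k                                          ≡⟨ offset-shift (s≤s (ℕₚ.≤-trans k≤c (ℕₚ.<⇒≤ 1+c≤n))) (fromℕ n) ⟨
      offset (fromℕ n) (shift k (fromℕ n))       ≡⟨ cong (offset (fromℕ n)) (lookup-top-copy k mem″) ⟨
      offset (fromℕ n) (lookup π (fromℕ n))      ≡⟨ cong (offset (fromℕ n)) (lookup-top-copy (suc c) mem′) ⟩
      offset (fromℕ n) (shift (suc c) (fromℕ n)) ≡⟨ offset-shift (s≤s 1+c≤n) (fromℕ n) ⟩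
      suc c                                      ∎)
      where open ≡-Reasoning

  extension-sound : ∀ {πs} → (∀ σ → σ ∈ πs → IsPerm σ) → ∀ c π → π ∈ extension c πs → IsPerm π
  extension-sound sound c π mem with ∈-extension⁻ c mem
  ... | k , _ , mem′ with ∈-map⁻ (relabel k ∘ lift) mem′
  ...   | σ , σ∈πs , refl = relabel-IsPerm k (lift σ) (lift-IsPerm σ (sound σ σ∈πs))

  -- π lies in the copy whose shift moves n + 1 to the last entry of π.
  extension-complete : ∀ {πs} → (∀ σ → IsPerm σ → σ ∈ πs) → ∀ π → IsPerm π → π ∈ extension n πs
  extension-complete {πs} complete π perm =
    ∈-extension⁺ n (ℕ.s≤s⁻¹ k<1+n) (subst (_∈ copy k πs) relabel-lift-σ (∈-map⁺ (relabel k ∘ lift) (complete σ σ-perm)))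
    where
    open ≡-Reasoning
    k : ℕ
    k = offset (fromℕ n) (lookup π (fromℕ n))
    k<1+n : k < suc n
    k<1+n = Finₚ.toℕ<n _
    π′ : Perm (suc n)
    π′ = relabel (suc n ∸ k) π
    π′-fixes-top : lookup π′ (fromℕ n) ≡ fromℕ n
    π′-fixes-top = begin
      lookup π′ (fromℕ n)                         ≡⟨ Vecₚ.lookup-map (fromℕ n) (shift (suc n ∸ k)) π ⟩
      shift (suc n ∸ k) (lookup π (fromℕ n))      ≡⟨ cong (shift (suc n ∸ k)) (shift-offset (fromℕ n) (lookup π (fromℕ n))) ⟨
      shift (suc n ∸ k) (shift k (fromℕ n))       ≡⟨ shift-inverse (ℕₚ.<⇒≤ k<1+n) (fromℕ n) ⟩
      fromℕ n                                     ∎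
    unlifted : Σ (Perm n) λ σ → IsPerm σ × lift σ ≡ π′
    unlifted = lift-surjective (relabel-IsPerm (suc n ∸ k) π perm) π′-fixes-top
    σ : Perm n
    σ = proj₁ unlifted
    σ-perm : IsPerm σ
    σ-perm = proj₁ (proj₂ unlifted)
    relabel-lift-σ : relabel k (lift σ) ≡ π
    relabel-lift-σ = begin
      relabel k (lift σ)       ≡⟨ cong (relabel k) (proj₂ (proj₂ unlifted)) ⟩
      relabel k π′             ≡⟨ relabel-+ (suc n ∸ k) k π ⟩
      relabel (suc n ∸ k + k) π ≡⟨ cong (λ j → relabel j π) (ℕₚ.m∸n+n≡m (ℕₚ.<⇒≤ k<1+n)) ⟩
      relabel (suc n) π        ≡⟨ relabel-full π ⟩
      π                        ∎

  extension-GrayCode : 1 ≤ n → ∀ {ts} → GrayCode n (idPerm n) (rotPerm n) ts →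
                       GrayCode (suc n) (idPerm (suc n)) (swappedId n) (extensionT n ts)
  extension-GrayCode 1≤n gray = record
    { listing  = extension n listing
    ; allPerm  = extension-complete allPerm
    ; onlyPerm = extension-sound onlyPerm n
    ; unique   = extension-Unique n ℕₚ.≤-refl unique
    ; steps    = extension-Steps 1≤n steps first last n
    ; first    = subst (First (extension n listing)) first-copy (extension-First n first)
    ; last     = subst (Last (extension n listing)) (last-copy 1≤n) (extension-Last n last)
    }
    where open GrayCode gray

  private
    ∑occ-extensionT : ∀ ts t c →
      ∑[ s ∈ extensionT c ts ] 𝟙 (s ≟ₜ t) + 𝟙 (bridge c ≟ₜ t) ≡
      ∑[ k < suc c ] (∑[ s ∈ copyT k ts ] 𝟙 (s ≟ₜ t) + 𝟙 (bridge k ≟ₜ t))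
    ∑occ-extensionT ts t zero    = refl
    ∑occ-extensionT ts t (suc c) = begin
      O (extensionT c ts ++ bridge c ∷ copyT (suc c) ts) + b (suc c)
        ≡⟨ cong (_+ b (suc c)) (∑∈-++ (extensionT c ts) (bridge c ∷ copyT (suc c) ts) (λ s → 𝟙 (s ≟ₜ t))) ⟩
      O (extensionT c ts) + (b c + O (copyT (suc c) ts)) + b (suc c)
        ≡⟨ regroup (O (extensionT c ts)) (b c) (O (copyT (suc c) ts)) (b (suc c)) ⟩
      (O (extensionT c ts) + b c) + (O (copyT (suc c) ts) + b (suc c))
        ≡⟨ cong (_+ (O (copyT (suc c) ts) + b (suc c))) (∑occ-extensionT ts t c) ⟩
      ∑[ k < suc (suc c) ] (O (copyT k ts) + b k) ∎
      where
      open ≡-Reasoning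
      O : List (Transp (suc n)) → ℕ
      O xs = ∑[ s ∈ xs ] 𝟙 (s ≟ₜ t)
      b : ℕ → ℕ
      b k = 𝟙 (bridge k ≟ₜ t)
      regroup : ∀ a b c d → a + (b + c) + d ≡ (a + b) + (c + d)
      regroup = solve-∀

    ∑occ-copyT : ∀ {ts} → All ValidT ts → ∀ {x y} → toℕ x < toℕ y →
      ∑[ k < suc n ] ∑[ s ∈ copyT k ts ] 𝟙 (s ≟ₜ (x , y)) ≡ gapCount ts (gap (x , y)) + gapCount ts (suc n ∸ gap (x , y))
    ∑occ-copyT {ts} valid {x} {y} x<y = begin
      ∑[ k < suc n ] ∑[ s ∈ copyT k ts ] 𝟙 (s ≟ₜ t)
        ≡⟨ ∑<-cong (suc n) (λ k _ → ∑∈-map (shiftT k ∘ liftT) ts (λ s → 𝟙 (s ≟ₜ t))) ⟩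
      ∑[ k < suc n ] ∑[ s ∈ ts ] 𝟙 (shiftT k (liftT s) ≟ₜ t)
        ≡⟨ ∑-comm (suc n) ts (λ k s → 𝟙 (shiftT k (liftT s) ≟ₜ t)) ⟩
      ∑[ s ∈ ts ] ∑[ k < suc n ] 𝟙 (shiftT k (liftT s) ≟ₜ t)
        ≡⟨ ∑∈-cong valid (λ { {i , j} i<j → trans (∑𝟙-shiftT (liftT-valid {t = i , j} i<j) x<y)
             (cong (λ d → 𝟙 (d ℕ.≟ e) + 𝟙 (d ℕ.≟ suc n ∸ e)) (gap-liftT (i , j))) }) ⟩
      ∑[ s ∈ ts ] (𝟙 (gap s ℕ.≟ e) + 𝟙 (gap s ℕ.≟ suc n ∸ e))
        ≡⟨ ∑∈-+ ts (λ s → 𝟙 (gap s ℕ.≟ e)) (λ s → 𝟙 (gap s ℕ.≟ suc n ∸ e)) ⟩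
      gapCount ts e + gapCount ts (suc n ∸ e) ∎
      where
      open ≡-Reasoning
      t : Transp (suc n)
      t = x , y
      e = gap t

  occ-cyclic-extensionT : 1 ≤ n → ∀ {ts} → All ValidT ts → ∀ t → ValidT t →
    occ t (bridge n ∷ extensionT n ts) ≡ closedGapCount ts (gap t) + closedGapCount ts (suc n ∸ gap t)
  occ-cyclic-extensionT 1≤n {ts} valid (x , y) x<y = begin
    occ t (bridge n ∷ extensionT n ts)
      ≡⟨ occ-∑ t (bridge n ∷ extensionT n ts) ⟩
    𝟙 (bridge n ≟ₜ t) + ∑[ s ∈ extensionT n ts ] 𝟙 (s ≟ₜ t)
      ≡⟨ ℕₚ.+-comm (𝟙 (bridge n ≟ₜ t)) _ ⟩
    ∑[ s ∈ extensionT n ts ] 𝟙 (s ≟ₜ t) + 𝟙 (bridge n ≟ₜ t)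
      ≡⟨ ∑occ-extensionT ts t n ⟩
    ∑[ k < suc n ] (∑[ s ∈ copyT k ts ] 𝟙 (s ≟ₜ t) + 𝟙 (bridge k ≟ₜ t))
      ≡⟨ ∑<-+ (suc n) (λ k → ∑[ s ∈ copyT k ts ] 𝟙 (s ≟ₜ t)) (λ k → 𝟙 (bridge k ≟ₜ t)) ⟩
    ∑[ k < suc n ] ∑[ s ∈ copyT k ts ] 𝟙 (s ≟ₜ t) + ∑[ k < suc n ] 𝟙 (bridge k ≟ₜ t)
      ≡⟨ cong (_+ ∑[ k < suc n ] 𝟙 (bridge k ≟ₜ t)) (∑occ-copyT valid x<y) ⟩
    gapCount ts e + gapCount ts (suc n ∸ e) + ∑[ k < suc n ] 𝟙 (bridge k ≟ₜ t)
      ≡⟨ cong (gapCount ts e + gapCount ts (suc n ∸ e) +_) bridges ⟩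
    gapCount ts e + gapCount ts (suc n ∸ e) + (𝟙 (n ℕ.≟ e) + 𝟙 (n ℕ.≟ suc n ∸ e))
      ≡⟨ +-interchange (gapCount ts e) (gapCount ts (suc n ∸ e)) (𝟙 (n ℕ.≟ e)) (𝟙 (n ℕ.≟ suc n ∸ e)) ⟩
    closedGapCount ts e + closedGapCount ts (suc n ∸ e) ∎
    where
    open ≡-Reasoning
    t : Transp (suc n)
    t = x , y
    e = gap t
    bridges : ∑[ k < suc n ] 𝟙 (bridge k ≟ₜ t) ≡ 𝟙 (n ℕ.≟ e) + 𝟙 (n ℕ.≟ suc n ∸ e)
    bridges = trans (∑𝟙-shiftT (bridge₀-valid 1≤n) x<y)
                    (cong (λ d → 𝟙 (d ℕ.≟ e) + 𝟙 (d ℕ.≟ suc n ∸ e)) (Finₚ.toℕ-fromℕ n))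

-- Complete listings of S_N have N! elements

record Enumeration (N : ℕ) (πs : List (Perm N)) : Set where
  field
    complete : ∀ π → IsPerm π → π ∈ πs
    sound    : ∀ π → π ∈ πs → IsPerm π
    unique   : Unique πs

extension-Enumeration : ∀ {n πs} → Enumeration n πs → Enumeration (suc n) (Extension.extension n n πs)
extension-Enumeration {n} E = record
  { complete = extension-complete complete
  ; sound    = extension-sound sound n
  ; unique   = extension-Unique n ℕₚ.≤-refl unique
  }
  where
  open Enumeration E
  open Extension n

enumeration : (N : ℕ) → List (Perm N)
enumeration zero    = Vec.[] ∷ []
enumeration (suc N) = Extension.extension N N (enumeration N)

enumeration-Enumeration : ∀ N → Enumeration N (enumeration N)
enumeration-Enumeration zero    = record
  { complete = λ { Vec.[] _ → here refl }
  ; sound    = λ { Vec.[] _ () }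
  ; unique   = [] AllPairs.∷ AllPairs.[]
  }
enumeration-Enumeration (suc N) = extension-Enumeration (enumeration-Enumeration N)

length-enumeration : ∀ N → length (enumeration N) ≡ N !
length-enumeration zero    = refl
length-enumeration (suc N) = trans (Extension.length-extension N N (enumeration N)) (cong (suc N *_) (length-enumeration N))

-- Duplicate-free lists with the same elements are permutations of each other; compare with the explicit enumeration.
Enumeration-length : ∀ {N πs} → Enumeration N πs → length πs ≡ N !
Enumeration-length {N} {πs} E =
  trans (↭-length (∼bag⇒↭ (unique∧set⇒bag unique (Enumeration.unique E′) same-elements))) (length-enumeration N)
  where
  open Enumeration E
  E′ = enumeration-Enumeration N
  same-elements : ∀ {π} → π ∈ πs ⇔ π ∈ enumeration N
  same-elements {π} = mk⇔ (Enumeration.complete E′ π ∘ sound π) (complete π ∘ Enumeration.sound E′ π)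

GrayCode-length : ∀ {N s e ts} → GrayCode N s e ts → suc (length ts) ≡ N !
GrayCode-length gray = trans (sym (Steps-length steps)) (Enumeration-length (record
  { complete = allPerm ; sound = onlyPerm ; unique = unique }))
  where open GrayCode gray

extension-Balanced : ∀ p {ts} → GrayCode (2 + p) (idPerm (2 + p)) (rotPerm (2 + p)) ts → AlmostBalanced (2 + p) ts →
  Balanced (3 + p) (Extension.extensionT (2 + p) (2 + p) ts) (lastTwo (2 + p))
extension-Balanced p {ts} gray balanced (x , y) x<y = begin
  occ t (lastTwo n ∷ extensionT n ts)
    ≡⟨ cong (λ c → occ t (c ∷ extensionT n ts)) (bridge-last 1≤n) ⟨
  occ t (bridge n ∷ extensionT n ts)
    ≡⟨ occ-cyclic-extensionT 1≤n valid t x<y ⟩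
  closedGapCount ts (gap t) + closedGapCount ts (3 + p ∸ gap t)
    ≡⟨ closedGapCount-complementary valid balanced (GrayCode-length gray) (ℕₚ.m<n⇒0<n∸m x<y) (ℕ.s≤s⁻¹ (gap<N t)) ⟩
  2 * (suc p) ! ∎
  where
  open ≡-Reasoning
  n = 2 + p
  open Extension n
  t : Transp (suc n)
  t = x , y
  1≤n : 1 ≤ n
  1≤n = s≤s z≤n
  valid : All ValidT ts
  valid = Steps-valid (GrayCode.steps gray)

proposition4p6 : (n : ℕ) → 1 ≤ n → 2 ∣ n →
    (ts : List (Transp n)) → GrayCode n (idPerm n) (rotPerm n) ts → AlmostBalanced n ts →
    Σ (List (Transp (suc n))) (λ us →
      GrayCode (suc n) (idPerm (suc n)) (swappedId n) us ×
      (idPerm (suc n) ≡ act (lastTwo n) (swappedId n)) ×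
      Balanced (suc n) us (lastTwo n))
proposition4p6 zero          ()
-- Evenness is used only to rule out n = 1; for n ≥ 2 parity forces it anyway.
proposition4p6 (suc zero)    _   2∣1 _  _    _        = contradiction (∣1⇒≡1 2∣1) λ ()
proposition4p6 (suc (suc p)) 1≤n _   ts gray balanced =
  extensionT (2 + p) ts ,
  extension-GrayCode 1≤n gray ,
  sym (act-involutive (lastTwo (2 + p)) (idPerm (3 + p))) ,
  extension-Balanced p gray balanced
  where open Extension (2 + p)
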